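{- For nonnegative integers $m,n$ with $(m,n)\neq(0,0)$, let $U_{m,n}$ be a configuration of $m$ points on the positive real axis and $n$ points on the positive imaginary axis of $\mathbb{C}$, let $u_{m,n}=|\textsc{NC}(U_{m,n})|$, and set $u_{0,0}=0$. Then \[\sum_{m,n\ge 0}u_{m,n}x^my^n=\frac{x+y-2xy}{1-2x-2y+3xy}.\]
   Context: For a finite set $P\subset\mathbb{C}$, a partition of $P$ is noncrossing if the convex hulls of its blocks are pairwise disjoint; $\textsc{NC}(P)$ is the set of noncrossing partitions of $P$. Its cardinality depends only on $m$ and $n$ for the configurations above. The value $u_{0,0}=0$ is the paper's convention for the empty configuration.
   Formalization: The points of each configuration $U_{m,n}$ have rational coordinates, so the configurations lie in ℚ×ℚ rather than in $\mathbb{C}$. -}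

module Defs where

open import Data.Nat as ℕ using (ℕ; zero; suc; _∸_)
open import Data.Integer as ℤ using (ℤ; +_; -[1+_])
open import Data.Rational as ℚ using (ℚ; 0ℚ; 1ℚ)
open import Data.Fin using (Fin; zero; suc; splitAt)
open import Data.Vec using (Vec; lookup)
open import Data.Bool using (Bool; true)
open import Data.Product using (_×_; _,_; Σ; ∃; ∃-syntax; proj₁; proj₂)
open import Data.Sum using (_⊎_; inj₁; inj₂)
open import Data.List using (List)
open import Data.List.Membership.Propositional using (_∈_)
open import Data.List.Relation.Unary.Unique.Propositional using (Unique)
open import Relation.Binary.PropositionalEquality using (_≡_)
open import Relation.Nullary using (¬_)
open import Function.Bundles using (_⇔_)

Point : Set
Point = ℚ × ℚ

sumℚ : ∀ {k} → (Fin k → ℚ) → ℚ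
sumℚ {zero}  f = 0ℚ
sumℚ {suc k} f = f zero ℚ.+ sumℚ (λ i → f (suc i))

-- Configuration U_{m,n}: m distinct points a_i > 0 on the positive real
-- axis and n distinct points i·b_j (b_j > 0) on the positive imaginary axis.

record Config (m n : ℕ) : Set where
  field
    re    : Fin m → ℚ
    im    : Fin n → ℚ
    re-pos : ∀ i → 0ℚ ℚ.< re i
    im-pos : ∀ j → 0ℚ ℚ.< im j
    re-inj : ∀ i i' → re i ≡ re i' → i ≡ i'
    im-inj : ∀ j j' → im j ≡ im j' → j ≡ j'

point : ∀ {m n} → Config m n → Fin (m ℕ.+ n) → Point
point {m} U l with splitAt m l
... | inj₁ i = Config.re U i , 0ℚ
... | inj₂ j = 0ℚ , Config.im U j

-- Set partitions of Fin k, encoded canonically by their "same block"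
-- relation as a k×k Boolean matrix which is an equivalence relation.

RelMat : ℕ → Set
RelMat k = Vec (Vec Bool k) k

SameBlock : ∀ {k} → RelMat k → Fin k → Fin k → Set
SameBlock R i j = lookup (lookup R i) j ≡ true

record IsPartition {k : ℕ} (R : RelMat k) : Set where
  field
    refl  : ∀ i → SameBlock R i i
    sym   : ∀ i j → SameBlock R i j → SameBlock R j i
    trans : ∀ i j l → SameBlock R i j → SameBlock R j l → SameBlock R i l

InHullOfBlock : ∀ {k} → (Fin k → Point) → RelMat k → Fin k → Point → Set
InHullOfBlock {k} p R i z =
  Σ (Fin k → ℚ) λ λ' →
      (∀ l → 0ℚ ℚ.≤ λ' l)
    × (∀ l → ¬ (λ' l ≡ 0ℚ) → SameBlock R i l)
    × (sumℚ λ' ≡ 1ℚ)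
    × (sumℚ (λ l → λ' l ℚ.* proj₁ (p l)) ≡ proj₁ z)
    × (sumℚ (λ l → λ' l ℚ.* proj₂ (p l)) ≡ proj₂ z)

IsNoncrossing : ∀ {k} → (Fin k → Point) → RelMat k → Set
IsNoncrossing p R =
  ∀ i j → ¬ SameBlock R i j →
    ¬ (Σ Point λ z → InHullOfBlock p R i z × InHullOfBlock p R j z)

NC : ∀ {k} → (Fin k → Point) → RelMat k → Set
NC p R = IsPartition R × IsNoncrossing p R

HasCard : ∀ {k} → (RelMat k → Set) → ℕ → Set
HasCard {k} P c =
  Σ (List (RelMat k)) λ L →
    Unique L × (Data.List.length L ≡ c) × (∀ R → (R ∈ L) ⇔ P R)

Series : Set
Series = ℕ → ℕ → ℤ

sumTo : ℕ → (ℕ → ℤ) → ℤ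
sumTo zero    f = f 0
sumTo (suc m) f = sumTo m f ℤ.+ f (suc m)

_⊛_ : Series → Series → Series
(f ⊛ g) m n = sumTo m λ i → sumTo n λ j → f i j ℤ.* g (m ∸ i) (n ∸ j)

-- 1 - 2x - 2y + 3xy
denom : Series
denom 0 0 = + 1
denom 1 0 = -[1+ 1 ]
denom 0 1 = -[1+ 1 ]
denom 1 1 = + 3
denom _ _ = + 0

-- x + y - 2xy
numer : Series
numer 1 0 = + 1
numer 0 1 = + 1
numer 1 1 = -[1+ 1 ]
numer _ _ = + 0

{-# OPTIONS --safe #-}
module Submission where

-- Listing the real points by decreasing and then the imaginary points by increasing modulus puts the
-- configuration on a path through the origin. A partition is noncrossing exactly when, along this path,
-- its blocks meet each axis in intervals and no two blocks cross from one axis to the other: a violation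
-- yields a point common to two hulls (a point of one block between two points of another, or two
-- crossing segments), and otherwise any two blocks are nested around the origin and a line
-- β x + α y = α β separates their hulls. Such partitions are counted by removing an end of the path:
-- the farthest real point, alone or joined to the next one; or, when the first block reaches the
-- imaginary axis (or there are no real points), the farthest imaginary point, alone, joined to the
-- previous point or to the first block. The resulting recursions make all coefficients of
-- (1 - 2x - 2y + 3xy) Σ u_{m,n} x^m y^n vanish except those of x, y and xy.

open import Defs using (Config)

module Partition where

  open import Defs
  open import Data.Nat using (ℕ; suc)
  open import Data.Fin using (Fin)
  open import Data.Maybe using (Maybe; just; nothing)
  open import Data.Vec using (lookup; tabulate)
  import Data.Vec.Properties as Vecₚ
  open import Data.Bool using (Bool; true; false)
  open import Data.Bool.Properties using (¬-not; not-¬)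
  open import Data.Product using (∃-syntax; _×_)
  import Data.Bool as Bool
  open import Relation.Nullary using (Dec; ¬_; contradiction)
  open import Relation.Binary.PropositionalEquality

  entry : ∀ {k} → RelMat k → Fin k → Fin k → Bool
  entry R i j = lookup (lookup R i) j

  tabulate² : ∀ {k} → (Fin k → Fin k → Bool) → RelMat k
  tabulate² f = tabulate (λ i → tabulate (f i))

  entry-tabulate² : ∀ {k} (f : Fin k → Fin k → Bool) i j → entry (tabulate² f) i j ≡ f i j
  entry-tabulate² f i j =
    trans (cong (λ row → lookup row j) (Vecₚ.lookup∘tabulate _ i)) (Vecₚ.lookup∘tabulate _ j)

  tabulate²-entry : ∀ {k} (R : RelMat k) → tabulate² (entry R) ≡ R
  tabulate²-entry R =
    trans (Vecₚ.tabulate-cong (λ i → Vecₚ.tabulate∘lookup (lookup R i))) (Vecₚ.tabulate∘lookup R)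

  relMat-ext : ∀ {k} {R R′ : RelMat k} → (∀ i j → entry R i j ≡ entry R′ i j) → R ≡ R′
  relMat-ext {R = R} {R′} eq = begin
    R                    ≡⟨ tabulate²-entry R ⟨
    tabulate² (entry R)  ≡⟨ Vecₚ.tabulate-cong (λ i → Vecₚ.tabulate-cong (eq i)) ⟩
    tabulate² (entry R′) ≡⟨ tabulate²-entry R′ ⟩
    R′                   ∎
    where open ≡-Reasoning

  sameBlock? : ∀ {k} (R : RelMat k) i j → Dec (SameBlock R i j)
  sameBlock? R i j = entry R i j Bool.≟ true

  module IsPartitionProperties {k} {R : RelMat k} (P : IsPartition R) where

    private module P = IsPartition P

    sameBlock-viaˡ : ∀ {x i j} → SameBlock R x i → SameBlock R x j → SameBlock R i j
    sameBlock-viaˡ {x} {i} {j} x∼i x∼j = P.trans i x j (P.sym x i x∼i) x∼j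

    sameBlock-viaʳ : ∀ {x i j} → SameBlock R i x → SameBlock R j x → SameBlock R i j
    sameBlock-viaʳ {x} {i} {j} i∼x j∼x = P.trans i x j i∼x (P.sym j x j∼x)

    entry-row : ∀ {x y} → SameBlock R x y → ∀ z → entry R x z ≡ entry R y z
    entry-row {x} {y} x∼y z with entry R y z in e
    ... | true  = P.trans x y z x∼y e
    ... | false = ¬-not (λ x∼z → not-¬ e (sameBlock-viaˡ x∼y x∼z))

    entry-column : ∀ {x y} → SameBlock R x y → ∀ z → entry R z x ≡ entry R z y
    entry-column {x} {y} x∼y z with entry R z y in e
    ... | true  = P.trans z y x e (P.sym x y x∼y)
    ... | false = ¬-not (λ z∼x → not-¬ e (P.trans z x y z∼x x∼y))

  reindex : ∀ {k k′} → (Fin k′ → Fin k) → RelMat k → RelMat k′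
  reindex f R = tabulate² (λ i j → entry R (f i) (f j))

  entry-reindex : ∀ {k k′} (f : Fin k′ → Fin k) R i j → entry (reindex f R) i j ≡ entry R (f i) (f j)
  entry-reindex f R = entry-tabulate² (λ i j → entry R (f i) (f j))

  reindex⁺ : ∀ {k k′} (f : Fin k′ → Fin k) R {i j} → SameBlock R (f i) (f j) → SameBlock (reindex f R) i j
  reindex⁺ f R = trans (entry-reindex f R _ _)

  reindex⁻ : ∀ {k k′} (f : Fin k′ → Fin k) R {i j} → SameBlock (reindex f R) i j → SameBlock R (f i) (f j)
  reindex⁻ f R = trans (sym (entry-reindex f R _ _))

  reindex-isPartition : ∀ {k k′} (f : Fin k′ → Fin k) {R} → IsPartition R → IsPartition (reindex f R)
  reindex-isPartition f {R} P = record
    { refl  = λ i → reindex⁺ f R (P.refl _)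
    ; sym   = λ i j h → reindex⁺ f R (P.sym _ _ (reindex⁻ f R h))
    ; trans = λ i j l h₁ h₂ → reindex⁺ f R (P.trans _ _ _ (reindex⁻ f R h₁) (reindex⁻ f R h₂))
    }
    where module P = IsPartition P

  reindex-inverse : ∀ {k} {f g : Fin k → Fin k} → (∀ i → g (f i) ≡ i) → ∀ R → reindex f (reindex g R) ≡ R
  reindex-inverse {f = f} {g} g∘f R = relMat-ext λ i j →
    trans (entry-reindex f (reindex g R) i j) (trans (entry-reindex g R (f i) (f j)) (cong₂ (entry R) (g∘f i) (g∘f j)))

  reindex-injective : ∀ {k} {f g : Fin k → Fin k} → (∀ i → g (f i) ≡ i) → ∀ {A B} → reindex g A ≡ reindex g B → A ≡ B
  reindex-injective {f = f} g∘f {A} {B} eq =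
    trans (sym (reindex-inverse g∘f A)) (trans (cong (reindex f) eq) (reindex-inverse g∘f B))

  Image : ∀ {k k′} → (RelMat k → RelMat k′) → (RelMat k → Set) → RelMat k′ → Set
  Image f P R = ∃[ R₀ ] P R₀ × R ≡ f R₀

  data Position {k} (embed : Fin k → Fin (suc k)) (new : Fin (suc k)) : Fin (suc k) → Set where
    fresh : Position embed new new
    old   : ∀ i → Position embed new (embed i)

  -- `insert nothing R` puts the new point into a block of its own,
  -- `insert (just c) R` puts it into the block of c.
  module Insertion {k : ℕ} (embed : Fin k → Fin (suc k)) (new : Fin (suc k))
                   (preimage : Fin (suc k) → Maybe (Fin k))
                   (preimage-embed : ∀ i → preimage (embed i) ≡ just i)
                   (preimage-new : preimage new ≡ nothing)
                   (position : ∀ a → Position embed new a) where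

    link : Maybe (Fin k) → RelMat k → Maybe (Fin k) → Maybe (Fin k) → Bool
    link _        R (just i) (just j) = entry R i j
    link _        R nothing  nothing  = true
    link nothing  R _        _        = false
    link (just c) R nothing  (just j) = entry R c j
    link (just c) R (just i) nothing  = entry R i c

    insert : Maybe (Fin k) → RelMat k → RelMat (suc k)
    insert o R = tabulate² (λ a b → link o R (preimage a) (preimage b))

    restrict : RelMat (suc k) → RelMat k
    restrict = reindex embed

    private
      entry-insert : ∀ o R {a b x y} → preimage a ≡ x → preimage b ≡ y →
                     entry (insert o R) a b ≡ link o R x y
      entry-insert o R {a} {b} refl refl = entry-tabulate² (λ a b → link o R (preimage a) (preimage b)) a b

      entry-insert-old : ∀ o R i j → entry (insert o R) (embed i) (embed j) ≡ entry R i j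
      entry-insert-old o R i j = entry-insert o R (preimage-embed i) (preimage-embed j)

    insert-old⁺ : ∀ o R {i j} → SameBlock R i j → SameBlock (insert o R) (embed i) (embed j)
    insert-old⁺ o R = trans (entry-insert-old o R _ _)

    insert-old⁻ : ∀ o R {i j} → SameBlock (insert o R) (embed i) (embed j) → SameBlock R i j
    insert-old⁻ o R = trans (sym (entry-insert-old o R _ _))

    insert-new : ∀ o R → SameBlock (insert o R) new new
    insert-new o R = entry-insert o R preimage-new preimage-new

    alone-new-old : ∀ R {j} → ¬ SameBlock (insert nothing R) new (embed j)
    alone-new-old R {j} = not-¬ (entry-insert nothing R preimage-new (preimage-embed j))

    alone-old-new : ∀ R {j} → ¬ SameBlock (insert nothing R) (embed j) new
    alone-old-new R {j} = not-¬ (entry-insert nothing R (preimage-embed j) preimage-new)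

    join-new-old⁺ : ∀ c R {j} → SameBlock R c j → SameBlock (insert (just c) R) new (embed j)
    join-new-old⁺ c R = trans (entry-insert (just c) R preimage-new (preimage-embed _))

    join-new-old⁻ : ∀ c R {j} → SameBlock (insert (just c) R) new (embed j) → SameBlock R c j
    join-new-old⁻ c R = trans (sym (entry-insert (just c) R preimage-new (preimage-embed _)))

    join-old-new⁺ : ∀ c R {j} → SameBlock R j c → SameBlock (insert (just c) R) (embed j) new
    join-old-new⁺ c R = trans (entry-insert (just c) R (preimage-embed _) preimage-new)

    join-old-new⁻ : ∀ c R {j} → SameBlock (insert (just c) R) (embed j) new → SameBlock R j c
    join-old-new⁻ c R = trans (sym (entry-insert (just c) R (preimage-embed _) preimage-new))

    restrict-insert : ∀ o R → restrict (insert o R) ≡ R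
    restrict-insert o R = relMat-ext λ i j → trans (entry-reindex embed (insert o R) i j) (entry-insert-old o R i j)

    insert-injective : ∀ o {R R′} → insert o R ≡ insert o R′ → R ≡ R′
    insert-injective o {R} {R′} eq =
      trans (sym (restrict-insert o R)) (trans (cong restrict eq) (restrict-insert o R′))

    insert-alone≢join : ∀ {R₀ R₁ c} → IsPartition R₁ → insert nothing R₀ ≢ insert (just c) R₁
    insert-alone≢join {R₀} {R₁} {c} P eq =
      alone-new-old R₀ (subst (λ R → SameBlock R new (embed c)) (sym eq) (join-new-old⁺ c R₁ (IsPartition.refl P c)))

    insert-isPartition : ∀ o {R} → IsPartition R → IsPartition (insert o R)
    insert-isPartition o {R} P = record { refl = reflexive ; sym = symmetric o ; trans = transitive o }
      where
      module P = IsPartition P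

      reflexive : ∀ a → SameBlock (insert o R) a a
      reflexive a with position a
      ... | fresh = insert-new o R
      ... | old i = insert-old⁺ o R (P.refl i)

      symmetric : ∀ o a b → SameBlock (insert o R) a b → SameBlock (insert o R) b a
      symmetric o        a b h with position a | position b
      ... | fresh | fresh = h
      ... | old i | old j = insert-old⁺ o R (P.sym i j (insert-old⁻ o R h))
      symmetric nothing  a b h | fresh | old j = contradiction h (alone-new-old R)
      symmetric nothing  a b h | old i | fresh = contradiction h (alone-old-new R)
      symmetric (just c) a b h | fresh | old j = join-old-new⁺ c R (P.sym c j (join-new-old⁻ c R h))
      symmetric (just c) a b h | old i | fresh = join-new-old⁺ c R (P.sym i c (join-old-new⁻ c R h))

      transitive : ∀ o a b d → SameBlock (insert o R) a b → SameBlock (insert o R) b d →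
                   SameBlock (insert o R) a d
      transitive o a b d h₁ h₂ with position a | position b | position d
      ... | fresh | fresh | _     = h₂
      ... | fresh | old i | fresh = insert-new o R
      ... | old i | fresh | fresh = h₁
      ... | old i | old j | old l = insert-old⁺ o R (P.trans i j l (insert-old⁻ o R h₁) (insert-old⁻ o R h₂))
      transitive nothing a b d h₁ h₂ | fresh | old i | old j = contradiction h₁ (alone-new-old R)
      transitive nothing a b d h₁ h₂ | old i | fresh | old j = contradiction h₁ (alone-old-new R)
      transitive nothing a b d h₁ h₂ | old i | old j | fresh = contradiction h₂ (alone-old-new R)
      transitive (just c) a b d h₁ h₂ | fresh | old i | old j =
        join-new-old⁺ c R (P.trans c i j (join-new-old⁻ c R h₁) (insert-old⁻ (just c) R h₂))
      transitive (just c) a b d h₁ h₂ | old i | fresh | old j =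
        insert-old⁺ (just c) R (P.trans i c j (join-old-new⁻ c R h₁) (join-new-old⁻ c R h₂))
      transitive (just c) a b d h₁ h₂ | old i | old j | fresh =
        join-old-new⁺ c R (P.trans i j c (insert-old⁻ (just c) R h₁) (join-old-new⁻ c R h₂))

    insert-alone-restrict : ∀ {R} → IsPartition R → (∀ i → ¬ SameBlock R new (embed i)) →
                            insert nothing (restrict R) ≡ R
    insert-alone-restrict {R} P alone = relMat-ext entries
      where
      entries : ∀ a b → entry (insert nothing (restrict R)) a b ≡ entry R a b
      entries a b with position a | position b
      ... | fresh | fresh = trans (insert-new _ _) (sym (IsPartition.refl P new))
      ... | fresh | old j = trans (entry-insert nothing _ preimage-new (preimage-embed j)) (sym (¬-not (alone j)))
      ... | old i | fresh = trans (entry-insert nothing _ (preimage-embed i) preimage-new)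
                                  (sym (¬-not (λ h → alone i (IsPartition.sym P _ _ h))))
      ... | old i | old j = trans (entry-insert-old nothing _ i j) (entry-reindex embed R i j)

    insert-join-restrict : ∀ {R c} → IsPartition R → SameBlock R new (embed c) →
                           insert (just c) (restrict R) ≡ R
    insert-join-restrict {R} {c} P new∼c = relMat-ext entries
      where
      open IsPartitionProperties P
      entries : ∀ a b → entry (insert (just c) (restrict R)) a b ≡ entry R a b
      entries a b with position a | position b
      ... | fresh | fresh = trans (insert-new _ _) (sym (IsPartition.refl P new))
      ... | fresh | old j = trans (entry-insert (just c) _ preimage-new (preimage-embed j))
                                  (trans (entry-reindex embed R c j) (sym (entry-row new∼c (embed j))))
      ... | old i | fresh = trans (entry-insert (just c) _ (preimage-embed i) preimage-new)
                                  (trans (entry-reindex embed R i c) (sym (entry-column new∼c (embed i))))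
      ... | old i | old j = trans (entry-insert-old (just c) _ i j) (entry-reindex embed R i j)

module PathPartition where

  open import Defs
  open Partition
  open import Data.Nat as ℕ using (ℕ; zero; suc; z≤n; s≤s)
  import Data.Nat.Properties as ℕP
  open import Data.Fin as F using (Fin; zero; suc; toℕ; inject₁; fromℕ)
  import Data.Fin.Properties as FP
  open import Data.Maybe using (Maybe; just; nothing)
  import Data.Maybe as Maybe
  open import Data.Product using (∃-syntax; _×_; _,_; proj₁)
  open import Data.Sum using (_⊎_; inj₁; inj₂)
  open import Relation.Nullary using (¬_; contradiction; yes; no)
  open import Relation.Nullary.Decidable using (_×-dec_)
  open import Relation.Binary.PropositionalEquality
  open import Function.Bundles using (_⇔_; mk⇔)

  -- The points 0, …, k - 1 lie along a path: the first m on the positive real axis by decreasing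
  -- modulus, the others on the positive imaginary axis by increasing modulus.
  record Uncrossed {k} (m : ℕ) (R : RelMat k) : Set where
    field
      intervalʳ  : ∀ {p q r} → p F.< q → q F.< r → toℕ r ℕ.< m → SameBlock R p r → SameBlock R p q
      intervalⁱ  : ∀ {p q r} → m ℕ.≤ toℕ p → p F.< q → q F.< r → SameBlock R p r → SameBlock R p q
      noCrossing : ∀ {p q r s} → p F.< q → toℕ q ℕ.< m → m ℕ.≤ toℕ r → r F.< s →
                   SameBlock R p r → SameBlock R q s → SameBlock R p q

  PathNC : ∀ {k} → ℕ → RelMat k → Set
  PathNC m R = IsPartition R × Uncrossed m R

  FirstBlockReal : ∀ {k} → ℕ → RelMat (suc k) → Set
  FirstBlockReal m R = ∀ l → m ℕ.≤ toℕ l → ¬ SameBlock R zero l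

  FirstBlockMixed : ∀ {k} → ℕ → RelMat (suc k) → Set
  FirstBlockMixed m R = ∃[ l ] m ℕ.≤ toℕ l × SameBlock R zero l

  firstBlockMixed⇒≤ : ∀ {k m} {R : RelMat (suc k)} → FirstBlockMixed m R → m ℕ.≤ k
  firstBlockMixed⇒≤ (l , m≤l , _) = ℕP.≤-trans m≤l (ℕ.s≤s⁻¹ (FP.toℕ<n l))

  unsuc : ∀ {k} → Fin (suc k) → Maybe (Fin k)
  unsuc zero    = nothing
  unsuc (suc i) = just i

  frontPosition : ∀ {k} (a : Fin (suc k)) → Position suc zero a
  frontPosition zero    = fresh
  frontPosition (suc i) = old i

  module Front {k} = Insertion {k} suc zero unsuc (λ _ → refl) refl frontPosition

  uninject₁ : ∀ {k} → Fin (suc k) → Maybe (Fin k)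
  uninject₁ {zero}  zero    = nothing
  uninject₁ {suc k} zero    = just zero
  uninject₁ {suc k} (suc i) = Maybe.map suc (uninject₁ i)

  uninject₁-inject₁ : ∀ {k} (i : Fin k) → uninject₁ (inject₁ i) ≡ just i
  uninject₁-inject₁ zero    = refl
  uninject₁-inject₁ (suc i) = cong (Maybe.map suc) (uninject₁-inject₁ i)

  uninject₁-fromℕ : ∀ k → uninject₁ (fromℕ k) ≡ nothing
  uninject₁-fromℕ zero    = refl
  uninject₁-fromℕ (suc k) = cong (Maybe.map suc) (uninject₁-fromℕ k)

  backPosition : ∀ {k} (a : Fin (suc k)) → Position inject₁ (fromℕ k) a
  backPosition {zero}  zero    = fresh
  backPosition {suc k} zero    = old zero
  backPosition {suc k} (suc a) with backPosition a
  ... | fresh = fresh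
  ... | old i = old (suc i)

  module Back {k} = Insertion {k} inject₁ (fromℕ k) uninject₁ uninject₁-inject₁ (uninject₁-fromℕ k) backPosition

  inject₁-cancel-< : ∀ {k} {i j : Fin k} → inject₁ i F.< inject₁ j → i F.< j
  inject₁-cancel-< {i = i} {j} = subst₂ ℕ._<_ (FP.toℕ-inject₁ i) (FP.toℕ-inject₁ j)

  inject₁-mono-< : ∀ {k} {i j : Fin k} → i F.< j → inject₁ i F.< inject₁ j
  inject₁-mono-< {i = i} {j} = subst₂ ℕ._<_ (sym (FP.toℕ-inject₁ i)) (sym (FP.toℕ-inject₁ j))

  inject₁<fromℕ : ∀ {k} (i : Fin k) → inject₁ i F.< fromℕ k
  inject₁<fromℕ {k} i = subst₂ ℕ._<_ (sym (FP.toℕ-inject₁ i)) (sym (FP.toℕ-fromℕ k)) (FP.toℕ<n i)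

  fromℕ≮ : ∀ {k} {a : Fin (suc k)} → ¬ fromℕ k F.< a
  fromℕ≮ {a = a} = ℕP.≤⇒≯ (FP.≤fromℕ a)

  ≡fromℕ⊎<fromℕ : ∀ {k} (j : Fin (suc k)) → j ≡ fromℕ k ⊎ j F.< fromℕ k
  ≡fromℕ⊎<fromℕ {k} j with j FP.≟ fromℕ k
  ... | yes j≡k = inj₁ j≡k
  ... | no  j≢k = inj₂ (FP.≤∧≢⇒< (FP.≤fromℕ j) j≢k)

  front-restrict : ∀ {k m} {R : RelMat (suc k)} → Uncrossed (suc m) R → Uncrossed m (Front.restrict R)
  front-restrict {R = R} U = record
    { intervalʳ  = λ p<q q<r r<m h → reindex⁺ suc R (U.intervalʳ (s≤s p<q) (s≤s q<r) (s≤s r<m) (reindex⁻ suc R h))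
    ; intervalⁱ  = λ m≤p p<q q<r h → reindex⁺ suc R (U.intervalⁱ (s≤s m≤p) (s≤s p<q) (s≤s q<r) (reindex⁻ suc R h))
    ; noCrossing = λ p<q q<m m≤r r<s h₁ h₂ → reindex⁺ suc R
        (U.noCrossing (s≤s p<q) (s≤s q<m) (s≤s m≤r) (s≤s r<s) (reindex⁻ suc R h₁) (reindex⁻ suc R h₂))
    }
    where module U = Uncrossed U

  back-restrict : ∀ {k m} {R : RelMat (suc k)} → Uncrossed m R → Uncrossed m (Back.restrict R)
  back-restrict {m = m} {R} U = record
    { intervalʳ  = λ {_} {_} {r} p<q q<r r<m h → reindex⁺ inject₁ R
        (U.intervalʳ (inject₁-mono-< p<q) (inject₁-mono-< q<r) (subst (ℕ._< m) (sym (FP.toℕ-inject₁ r)) r<m)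
                     (reindex⁻ inject₁ R h))
    ; intervalⁱ  = λ {p} m≤p p<q q<r h → reindex⁺ inject₁ R
        (U.intervalⁱ (subst (m ℕ.≤_) (sym (FP.toℕ-inject₁ p)) m≤p) (inject₁-mono-< p<q) (inject₁-mono-< q<r)
                     (reindex⁻ inject₁ R h))
    ; noCrossing = λ {_} {q} {r} p<q q<m m≤r r<s h₁ h₂ → reindex⁺ inject₁ R
        (U.noCrossing (inject₁-mono-< p<q) (subst (ℕ._< m) (sym (FP.toℕ-inject₁ q)) q<m)
                      (subst (m ℕ.≤_) (sym (FP.toℕ-inject₁ r)) m≤r) (inject₁-mono-< r<s)
                      (reindex⁻ inject₁ R h₁) (reindex⁻ inject₁ R h₂))
    }
    where module U = Uncrossed U

  module _ {k m : ℕ} {R : RelMat (suc k)} where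

    front-uncrossed :
      Uncrossed m (Front.restrict R) →
      (∀ {j l} → j F.< l → toℕ l ℕ.< m → SameBlock R zero (suc l) → SameBlock R zero (suc j)) →
      (∀ {j l t} → toℕ j ℕ.< m → m ℕ.≤ toℕ l → l F.< t →
         SameBlock R zero (suc l) → SameBlock R (suc j) (suc t) → SameBlock R zero (suc j)) →
      Uncrossed (suc m) R
    front-uncrossed U firstʳ firstⁿ =
      record { intervalʳ = interval-real ; intervalⁱ = interval-imag ; noCrossing = no-crossing }
      where
      module U = Uncrossed U

      old⁺ : ∀ {i j} → SameBlock (Front.restrict R) i j → SameBlock R (suc i) (suc j)
      old⁺ = reindex⁻ suc R

      old⁻ : ∀ {i j} → SameBlock R (suc i) (suc j) → SameBlock (Front.restrict R) i j
      old⁻ = reindex⁺ suc R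

      interval-real : ∀ {p q r} → p F.< q → q F.< r → toℕ r ℕ.< suc m → SameBlock R p r → SameBlock R p q
      interval-real {zero}  {suc q} {suc r} _         (s≤s q<r) (s≤s r<m) h = firstʳ q<r r<m h
      interval-real {suc p} {suc q} {suc r} (s≤s p<q) (s≤s q<r) (s≤s r<m) h =
        old⁺ (U.intervalʳ p<q q<r r<m (old⁻ h))

      interval-imag : ∀ {p q r} → suc m ℕ.≤ toℕ p → p F.< q → q F.< r → SameBlock R p r → SameBlock R p q
      interval-imag {suc p} {suc q} {suc r} (s≤s m≤p) (s≤s p<q) (s≤s q<r) h =
        old⁺ (U.intervalⁱ m≤p p<q q<r (old⁻ h))

      no-crossing : ∀ {p q r s} → p F.< q → toℕ q ℕ.< suc m → suc m ℕ.≤ toℕ r → r F.< s →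
                    SameBlock R p r → SameBlock R q s → SameBlock R p q
      no-crossing {zero}  {suc q} {suc r} {suc s} _ (s≤s q<m) (s≤s m≤r) (s≤s r<s) h₁ h₂ = firstⁿ q<m m≤r r<s h₁ h₂
      no-crossing {suc p} {suc q} {suc r} {suc s} (s≤s p<q) (s≤s q<m) (s≤s m≤r) (s≤s r<s) h₁ h₂ =
        old⁺ (U.noCrossing p<q q<m m≤r r<s (old⁻ h₁) (old⁻ h₂))

    back-uncrossed :
      Uncrossed m (Back.restrict R) →
      (∀ {i j} → i F.< j → k ℕ.< m → SameBlock R (inject₁ i) (fromℕ k) → SameBlock R (inject₁ i) (inject₁ j)) →
      (∀ {i j} → m ℕ.≤ toℕ i → i F.< j → SameBlock R (inject₁ i) (fromℕ k) → SameBlock R (inject₁ i) (inject₁ j)) →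
      (∀ {i j l} → i F.< j → toℕ j ℕ.< m → m ℕ.≤ toℕ l →
         SameBlock R (inject₁ i) (inject₁ l) → SameBlock R (inject₁ j) (fromℕ k) → SameBlock R (inject₁ i) (inject₁ j)) →
      Uncrossed m R
    back-uncrossed U lastʳ lastⁱ lastⁿ =
      record { intervalʳ = interval-real ; intervalⁱ = interval-imag ; noCrossing = no-crossing }
      where
      module U = Uncrossed U

      old⁺ : ∀ {i j} → SameBlock (Back.restrict R) i j → SameBlock R (inject₁ i) (inject₁ j)
      old⁺ = reindex⁻ inject₁ R

      old⁻ : ∀ {i j} → SameBlock R (inject₁ i) (inject₁ j) → SameBlock (Back.restrict R) i j
      old⁻ = reindex⁺ inject₁ R

      interval-real : ∀ {p q r} → p F.< q → q F.< r → toℕ r ℕ.< m → SameBlock R p r → SameBlock R p q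
      interval-real {p} {q} {r} p<q q<r r<m h with backPosition p | backPosition q | backPosition r
      ... | fresh | _     | _     = contradiction p<q fromℕ≮
      ... | old i | fresh | _     = contradiction q<r fromℕ≮
      ... | old i | old j | fresh = lastʳ (inject₁-cancel-< p<q) (subst (ℕ._< m) (FP.toℕ-fromℕ k) r<m) h
      ... | old i | old j | old l =
        old⁺ (U.intervalʳ (inject₁-cancel-< p<q) (inject₁-cancel-< q<r) (subst (ℕ._< m) (FP.toℕ-inject₁ l) r<m) (old⁻ h))

      interval-imag : ∀ {p q r} → m ℕ.≤ toℕ p → p F.< q → q F.< r → SameBlock R p r → SameBlock R p q
      interval-imag {p} {q} {r} m≤p p<q q<r h with backPosition p | backPosition q | backPosition r
      ... | fresh | _     | _     = contradiction p<q fromℕ≮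
      ... | old i | fresh | _     = contradiction q<r fromℕ≮
      ... | old i | old j | fresh = lastⁱ (subst (m ℕ.≤_) (FP.toℕ-inject₁ i) m≤p) (inject₁-cancel-< p<q) h
      ... | old i | old j | old l =
        old⁺ (U.intervalⁱ (subst (m ℕ.≤_) (FP.toℕ-inject₁ i) m≤p) (inject₁-cancel-< p<q) (inject₁-cancel-< q<r) (old⁻ h))

      no-crossing : ∀ {p q r s} → p F.< q → toℕ q ℕ.< m → m ℕ.≤ toℕ r → r F.< s →
                    SameBlock R p r → SameBlock R q s → SameBlock R p q
      no-crossing {p} {q} {r} {s} p<q q<m m≤r r<s h₁ h₂
        with backPosition p | backPosition q | backPosition r | backPosition s
      ... | fresh | _     | _     | _     = contradiction p<q fromℕ≮
      ... | old i | fresh | _     | _     = contradiction (ℕP.<-≤-trans q<m m≤r) fromℕ≮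
      ... | old i | old j | fresh | _     = contradiction r<s fromℕ≮
      ... | old i | old j | old l | fresh =
        lastⁿ (inject₁-cancel-< p<q) (subst (ℕ._< m) (FP.toℕ-inject₁ j) q<m) (subst (m ℕ.≤_) (FP.toℕ-inject₁ l) m≤r) h₁ h₂
      ... | old i | old j | old l | old t =
        old⁺ (U.noCrossing (inject₁-cancel-< p<q) (subst (ℕ._< m) (FP.toℕ-inject₁ j) q<m)
                           (subst (m ℕ.≤_) (FP.toℕ-inject₁ l) m≤r) (inject₁-cancel-< r<s) (old⁻ h₁) (old⁻ h₂))

  front-alone : ∀ {k m} {R : RelMat k} → Uncrossed m R → Uncrossed (suc m) (Front.insert nothing R)
  front-alone {R = R} U = front-uncrossed (subst (Uncrossed _) (sym (Front.restrict-insert nothing R)) U)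
    (λ _ _ h → contradiction h (Front.alone-new-old R))
    (λ _ _ _ h _ → contradiction h (Front.alone-new-old R))

  front-alone-real : ∀ {k m} {R : RelMat k} → FirstBlockReal (suc m) (Front.insert nothing R)
  front-alone-real {R = R} (suc l) _ = Front.alone-new-old R

  front-join : ∀ {k m} {R : RelMat (suc k)} → IsPartition R → Uncrossed (suc m) R → FirstBlockReal (suc m) R →
               Uncrossed (suc (suc m)) (Front.insert (just zero) R)
  front-join {m = m} {R} P U real =
    front-uncrossed (subst (Uncrossed _) (sym (Front.restrict-insert (just zero) R)) U) firstʳ firstⁿ
    where
    R′ = Front.insert (just zero) R

    firstʳ : ∀ {j l} → j F.< l → toℕ l ℕ.< suc m → SameBlock R′ zero (suc l) → SameBlock R′ zero (suc j)
    firstʳ {zero}  _   _   _ = Front.join-new-old⁺ zero R (IsPartition.refl P zero)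
    firstʳ {suc j} j<l l<m h =
      Front.join-new-old⁺ zero R (Uncrossed.intervalʳ U {zero} (s≤s z≤n) j<l l<m (Front.join-new-old⁻ zero R h))

    firstⁿ : ∀ {j l t} → toℕ j ℕ.< suc m → suc m ℕ.≤ toℕ l → l F.< t →
             SameBlock R′ zero (suc l) → SameBlock R′ (suc j) (suc t) → SameBlock R′ zero (suc j)
    firstⁿ _ m≤l _ h _ = contradiction (Front.join-new-old⁻ zero R h) (real _ m≤l)

  front-join-real : ∀ {k m} {R : RelMat (suc k)} → FirstBlockReal (suc m) R →
                    FirstBlockReal (suc (suc m)) (Front.insert (just zero) R)
  front-join-real {R = R} real (suc l) (s≤s m≤l) h = real l m≤l (Front.join-new-old⁻ zero R h)

  back-alone : ∀ {k m} {R : RelMat k} → Uncrossed m R → Uncrossed m (Back.insert nothing R)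
  back-alone {R = R} U = back-uncrossed (subst (Uncrossed _) (sym (Back.restrict-insert nothing R)) U)
    (λ {i} _ _ h → contradiction h (Back.alone-old-new R {i}))
    (λ {i} _ _ h → contradiction h (Back.alone-old-new R {i}))
    (λ {_} {j} _ _ _ _ h → contradiction h (Back.alone-old-new R {j}))

  back-join-last : ∀ {k m} {R : RelMat (suc k)} → IsPartition R → Uncrossed m R → m ℕ.≤ k →
                   Uncrossed m (Back.insert (just (fromℕ k)) R)
  back-join-last {k} {m} {R} P U m≤k =
    back-uncrossed (subst (Uncrossed _) (sym (Back.restrict-insert (just c) R)) U) lastʳ lastⁱ lastⁿ
    where
    c  = fromℕ k
    R′ = Back.insert (just c) R
    module U = Uncrossed U
    open IsPartitionProperties P

    lastʳ : ∀ {i j} → i F.< j → suc k ℕ.< m → SameBlock R′ (inject₁ i) (fromℕ (suc k)) →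
            SameBlock R′ (inject₁ i) (inject₁ j)
    lastʳ _ k<m _ = contradiction (ℕP.≤-trans m≤k (ℕP.n≤1+n k)) (ℕP.<⇒≱ k<m)

    lastⁱ : ∀ {i j} → m ℕ.≤ toℕ i → i F.< j → SameBlock R′ (inject₁ i) (fromℕ (suc k)) →
            SameBlock R′ (inject₁ i) (inject₁ j)
    lastⁱ {i} {j} m≤i i<j h with ≡fromℕ⊎<fromℕ j
    ... | inj₁ refl = Back.insert-old⁺ (just c) R (Back.join-old-new⁻ c R {i} h)
    ... | inj₂ j<c  = Back.insert-old⁺ (just c) R (U.intervalⁱ m≤i i<j j<c (Back.join-old-new⁻ c R h))

    lastⁿ : ∀ {i j l} → i F.< j → toℕ j ℕ.< m → m ℕ.≤ toℕ l → SameBlock R′ (inject₁ i) (inject₁ l) →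
            SameBlock R′ (inject₁ j) (fromℕ (suc k)) → SameBlock R′ (inject₁ i) (inject₁ j)
    lastⁿ {i} {j} {l} i<j j<m m≤l h₁ h₂ with ≡fromℕ⊎<fromℕ l
    ... | inj₁ refl =
      Back.insert-old⁺ (just c) R (sameBlock-viaʳ (Back.insert-old⁻ (just c) R {i} h₁) (Back.join-old-new⁻ c R {j} h₂))
    ... | inj₂ l<c  =
      Back.insert-old⁺ (just c) R (U.noCrossing i<j j<m m≤l l<c (Back.insert-old⁻ (just c) R h₁) (Back.join-old-new⁻ c R h₂))

  back-join-first : ∀ {k m} {R : RelMat (suc k)} → IsPartition R → Uncrossed (suc m) R → FirstBlockReal (suc m) R →
                    m ℕ.≤ k → Uncrossed (suc m) (Back.insert (just zero) R)
  back-join-first {k} {m} {R} P U real m≤k =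
    back-uncrossed (subst (Uncrossed _) (sym (Back.restrict-insert (just zero) R)) U) lastʳ lastⁱ lastⁿ
    where
    R′ = Back.insert (just zero) R
    module P = IsPartition P

    lastʳ : ∀ {i j} → i F.< j → suc k ℕ.< suc m → SameBlock R′ (inject₁ i) (fromℕ (suc k)) →
            SameBlock R′ (inject₁ i) (inject₁ j)
    lastʳ _ k<m _ = contradiction (s≤s m≤k) (ℕP.<⇒≱ k<m)

    lastⁱ : ∀ {i j} → suc m ℕ.≤ toℕ i → i F.< j → SameBlock R′ (inject₁ i) (fromℕ (suc k)) →
            SameBlock R′ (inject₁ i) (inject₁ j)
    lastⁱ {i} m≤i _ h = contradiction (P.sym i zero (Back.join-old-new⁻ zero R h)) (real i m≤i)

    -- Vacuous: j lies in the first block, which then absorbs i and with it the imaginary point l.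
    lastⁿ : ∀ {i j l} → i F.< j → toℕ j ℕ.< suc m → suc m ℕ.≤ toℕ l → SameBlock R′ (inject₁ i) (inject₁ l) →
            SameBlock R′ (inject₁ j) (fromℕ (suc k)) → SameBlock R′ (inject₁ i) (inject₁ j)
    lastⁿ {zero}  {j} {l} _   _   m≤l h₁ _  = contradiction (Back.insert-old⁻ (just zero) R h₁) (real l m≤l)
    lastⁿ {suc i} {j} {l} i<j j<m m≤l h₁ h₂ =
      contradiction (P.trans zero (suc i) l 0∼i (Back.insert-old⁻ (just zero) R h₁)) (real l m≤l)
      where
      0∼i : SameBlock R zero (suc i)
      0∼i = Uncrossed.intervalʳ U {zero} (s≤s z≤n) i<j j<m (P.sym j zero (Back.join-old-new⁻ zero R h₂))

  back-join-first-mixed : ∀ {k m} {R : RelMat (suc k)} → IsPartition R → m ℕ.≤ k →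
                          FirstBlockMixed (suc m) (Back.insert (just zero) R)
  back-join-first-mixed {k} {m} {R} P m≤k =
    fromℕ (suc k) , subst (suc m ℕ.≤_) (sym (FP.toℕ-fromℕ (suc k))) (s≤s m≤k) ,
    Back.join-old-new⁺ zero R (IsPartition.refl P zero)

  back-mixed : ∀ {k m} {R : RelMat (suc k)} o → FirstBlockMixed m R → FirstBlockMixed m (Back.insert o R)
  back-mixed {m = m} {R} o (l , m≤l , h) =
    inject₁ l , subst (m ℕ.≤_) (sym (FP.toℕ-inject₁ l)) m≤l , Back.insert-old⁺ o R h

  RealFirst : ∀ {k} → ℕ → RelMat (suc k) → Set
  RealFirst m R = PathNC (suc m) R × FirstBlockReal (suc m) R

  MixedFirst : ∀ {k} → ℕ → RelMat (suc k) → Set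
  MixedFirst m R = PathNC (suc m) R × FirstBlockMixed (suc m) R

  front-restrict-pathNC : ∀ {k m} {R : RelMat (suc k)} → PathNC (suc m) R → PathNC m (Front.restrict R)
  front-restrict-pathNC (P , U) = reindex-isPartition suc P , front-restrict U

  back-restrict-pathNC : ∀ {k m} {R : RelMat (suc k)} → PathNC m R → PathNC m (Back.restrict R)
  back-restrict-pathNC (P , U) = reindex-isPartition inject₁ P , back-restrict U

  last-joins-previous : ∀ {k m j} {R : RelMat (suc (suc k))} → PathNC m R → m ℕ.≤ toℕ j →
                        SameBlock R (fromℕ (suc k)) (inject₁ j) → SameBlock R (fromℕ (suc k)) (inject₁ (fromℕ k))
  last-joins-previous {k} {m} {j} (P , U) m≤j h with ≡fromℕ⊎<fromℕ j
  ... | inj₁ refl = h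
  ... | inj₂ j<c  = P.trans _ _ _ h (Uncrossed.intervalⁱ U (subst (m ℕ.≤_) (sym (FP.toℕ-inject₁ j)) m≤j)
                                       (inject₁-mono-< j<c) (inject₁<fromℕ (fromℕ k)) (P.sym _ _ h))
    where module P = IsPartition P

  -- The first block reaches the imaginary axis, so the segment from a real point i to the last point
  -- crosses it unless both lie in it.
  first-joins-last : ∀ {k m i} {R : RelMat (suc (suc k))} → PathNC (suc m) R → FirstBlockMixed (suc m) R →
                     toℕ i ℕ.< suc m → SameBlock R (fromℕ (suc k)) (inject₁ i) → SameBlock R zero (fromℕ (suc k))
  first-joins-last {k} {m} {i} (P , U) (l , m≤l , 0∼l) i<m h with backPosition l | i
  ... | fresh  | _      = 0∼l
  ... | old _  | zero   = IsPartition.sym P _ _ h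
  ... | old l′ | suc i′ =
    P.trans _ _ _ (Uncrossed.noCrossing U (s≤s z≤n) (subst (ℕ._< suc m) (sym (FP.toℕ-inject₁ (suc i′))) i<m) m≤l
                                       (inject₁<fromℕ l′) 0∼l (P.sym _ _ h)) (P.sym _ _ h)
    where module P = IsPartition P

  pathNC₀-one⇔ : (R : RelMat 1) → PathNC 0 R ⇔ Image (Back.insert nothing) (PathNC 0) R
  pathNC₀-one⇔ R = mk⇔
    (λ pnc → Back.restrict R , back-restrict-pathNC pnc , sym (Back.insert-alone-restrict (proj₁ pnc) (λ ())))
    (λ { (R₀ , (P₀ , U₀) , refl) → Back.insert-isPartition nothing P₀ , back-alone U₀ })

  pathNC₀-suc⇔ : ∀ {k} (R : RelMat (suc (suc k))) →
                 PathNC 0 R ⇔ (Image (Back.insert nothing) (PathNC 0) R ⊎ Image (Back.insert (just (fromℕ k))) (PathNC 0) R)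
  pathNC₀-suc⇔ {k} R = mk⇔ to from
    where
    to : PathNC 0 R → Image (Back.insert nothing) (PathNC 0) R ⊎ Image (Back.insert (just (fromℕ k))) (PathNC 0) R
    to pnc@(P , _) with FP.any? (λ i → sameBlock? R (fromℕ (suc k)) (inject₁ i))
    ... | no alone =
      inj₁ (Back.restrict R , back-restrict-pathNC pnc , sym (Back.insert-alone-restrict P (λ i h → alone (i , h))))
    ... | yes (_ , h) =
      inj₂ (Back.restrict R , back-restrict-pathNC pnc , sym (Back.insert-join-restrict P (last-joins-previous pnc z≤n h)))

    from : Image (Back.insert nothing) (PathNC 0) R ⊎ Image (Back.insert (just (fromℕ k))) (PathNC 0) R → PathNC 0 R
    from (inj₁ (_ , (P₀ , U₀) , refl)) = Back.insert-isPartition nothing P₀ , back-alone U₀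
    from (inj₂ (_ , (P₀ , U₀) , refl)) = Back.insert-isPartition (just (fromℕ k)) P₀ , back-join-last P₀ U₀ z≤n

  realFirst-zero⇔ : ∀ {k} (R : RelMat (suc k)) → RealFirst 0 R ⇔ Image (Front.insert nothing) (PathNC 0) R
  realFirst-zero⇔ R = mk⇔
    (λ { (pnc@(P , _) , real) →
         Front.restrict R , front-restrict-pathNC pnc , sym (Front.insert-alone-restrict P (λ i → real (suc i) (s≤s z≤n))) })
    (λ { (R₀ , (P₀ , U₀) , refl) → (Front.insert-isPartition nothing P₀ , front-alone U₀) , front-alone-real {R = R₀} })

  realFirst-suc⇔ : ∀ {k m} (R : RelMat (suc (suc k))) →
                   RealFirst (suc m) R ⇔ (Image (Front.insert nothing) (PathNC (suc m)) R ⊎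
                                          Image (Front.insert (just zero)) (RealFirst m) R)
  realFirst-suc⇔ {k} {m} R = mk⇔ to from
    where
    to : RealFirst (suc m) R →
         Image (Front.insert nothing) (PathNC (suc m)) R ⊎ Image (Front.insert (just zero)) (RealFirst m) R
    to (pnc@(P , U) , real) with sameBlock? R zero (suc zero)
    ... | yes 0∼1 = inj₂ (Front.restrict R , (front-restrict-pathNC pnc , real′) , sym (Front.insert-join-restrict P 0∼1))
      where
      real′ : FirstBlockReal (suc m) (Front.restrict R)
      real′ l m≤l h = real (suc l) (s≤s m≤l) (IsPartition.trans P zero (suc zero) (suc l) 0∼1 (reindex⁻ suc R h))
    ... | no 0≁1 = inj₁ (Front.restrict R , front-restrict-pathNC pnc , sym (Front.insert-alone-restrict P alone))
      where
      alone : ∀ i → ¬ SameBlock R zero (suc i)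
      alone zero    = 0≁1
      alone (suc i) h with suc (suc m) ℕ.≤? toℕ (suc (suc i))
      ... | yes m≤i = real _ m≤i h
      ... | no  m≰i = 0≁1 (Uncrossed.intervalʳ U {zero} {suc zero} (s≤s z≤n) (s≤s (s≤s z≤n)) (ℕP.≰⇒> m≰i) h)

    from : Image (Front.insert nothing) (PathNC (suc m)) R ⊎ Image (Front.insert (just zero)) (RealFirst m) R →
           RealFirst (suc m) R
    from (inj₁ (R₀ , (P₀ , U₀) , refl)) =
      (Front.insert-isPartition nothing P₀ , front-alone U₀) , front-alone-real {R = R₀}
    from (inj₂ (R₀ , ((P₀ , U₀) , real₀) , refl)) =
      (Front.insert-isPartition (just zero) P₀ , front-join P₀ U₀ real₀) , front-join-real {R = R₀} real₀

  mixedFirst-remove-last : ∀ {k m} (R : RelMat (suc (suc k))) → MixedFirst m R →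
                           Image (Back.insert nothing) (MixedFirst m) R ⊎
                           (Image (Back.insert (just (fromℕ k))) (MixedFirst m) R ⊎
                            Image (Back.insert (just zero)) (RealFirst m) R)
  mixedFirst-remove-last {k} {m} R (pnc@(P , U) , mixed@(l , m≤l , 0∼l))
    with sameBlock? R (fromℕ (suc k)) (inject₁ (fromℕ k)) ×-dec (suc m ℕ.≤? k)
  ... | yes (new∼c , m<k) =
    inj₂ (inj₁ (Back.restrict R , (back-restrict-pathNC pnc , mixed′) , sym (Back.insert-join-restrict P new∼c)))
    where
    mixed′ : FirstBlockMixed (suc m) (Back.restrict R)
    mixed′ with backPosition l
    ... | fresh  = fromℕ k , subst (suc m ℕ.≤_) (sym (FP.toℕ-fromℕ k)) m<k ,
                   reindex⁺ inject₁ R (IsPartition.trans P _ _ _ 0∼l new∼c)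
    ... | old l′ = l′ , subst (suc m ℕ.≤_) (FP.toℕ-inject₁ l′) m≤l , reindex⁺ inject₁ R 0∼l
  ... | no ¬join-last with FP.any? (λ i → sameBlock? R (fromℕ (suc k)) (inject₁ i))
  ...   | no alone =
    inj₁ (Back.restrict R , (back-restrict-pathNC pnc , mixed′) ,
          sym (Back.insert-alone-restrict P (λ i h → alone (i , h))))
    where
    mixed′ : FirstBlockMixed (suc m) (Back.restrict R)
    mixed′ with backPosition l
    ... | fresh  = contradiction (zero , IsPartition.sym P _ _ 0∼l) alone
    ... | old l′ = l′ , subst (suc m ℕ.≤_) (FP.toℕ-inject₁ l′) m≤l , reindex⁺ inject₁ R 0∼l
  ...   | yes (i , new∼i) =
    inj₂ (inj₂ (Back.restrict R , (back-restrict-pathNC pnc , real′) ,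
                sym (Back.insert-join-restrict P (IsPartition.sym P _ _ 0∼new))))
    where
    no-imaginary : ∀ j → suc m ℕ.≤ toℕ j → ¬ SameBlock R (fromℕ (suc k)) (inject₁ j)
    no-imaginary j m≤j h = ¬join-last (last-joins-previous pnc m≤j h , ℕP.≤-trans m≤j (ℕ.s≤s⁻¹ (FP.toℕ<n j)))

    0∼new : SameBlock R zero (fromℕ (suc k))
    0∼new = first-joins-last pnc mixed (ℕP.≰⇒> (λ m≤i → no-imaginary i m≤i new∼i)) new∼i

    real′ : FirstBlockReal (suc m) (Back.restrict R)
    real′ j m≤j h = no-imaginary j m≤j (IsPartition.trans P _ _ _ (IsPartition.sym P _ _ 0∼new) (reindex⁻ inject₁ R h))

  mixedFirst-suc⇔ : ∀ {k m} → m ℕ.≤ k → (R : RelMat (suc (suc k))) →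
                    MixedFirst m R ⇔ (Image (Back.insert nothing) (MixedFirst m) R ⊎
                                      (Image (Back.insert (just (fromℕ k))) (MixedFirst m) R ⊎
                                       Image (Back.insert (just zero)) (RealFirst m) R))
  mixedFirst-suc⇔ {k} {m} m≤k R = mk⇔ (mixedFirst-remove-last R) from
    where
    from : Image (Back.insert nothing) (MixedFirst m) R ⊎
           (Image (Back.insert (just (fromℕ k))) (MixedFirst m) R ⊎ Image (Back.insert (just zero)) (RealFirst m) R) →
           MixedFirst m R
    from (inj₁ (R₀ , ((P₀ , U₀) , mixed₀) , refl)) =
      (Back.insert-isPartition nothing P₀ , back-alone U₀) , back-mixed {R = R₀} nothing mixed₀
    from (inj₂ (inj₁ (R₀ , ((P₀ , U₀) , mixed₀) , refl))) =
      (Back.insert-isPartition (just (fromℕ k)) P₀ , back-join-last P₀ U₀ (firstBlockMixed⇒≤ {R = R₀} mixed₀)) ,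
      back-mixed {R = R₀} (just (fromℕ k)) mixed₀
    from (inj₂ (inj₂ (_ , ((P₀ , U₀) , real₀) , refl))) =
      (Back.insert-isPartition (just zero) P₀ , back-join-first P₀ U₀ real₀ m≤k) , back-join-first-mixed P₀ m≤k

  pathNC-RelMat0 : ∀ {m} (R : RelMat 0) → PathNC m R
  pathNC-RelMat0 R = record { refl = λ () ; sym = λ () ; trans = λ () } ,
                     record { intervalʳ = λ { {()} } ; intervalⁱ = λ { {()} } ; noCrossing = λ { {()} } }

  pathNC-suc⇔ : ∀ {k m} (R : RelMat (suc k)) → PathNC (suc m) R ⇔ (RealFirst m R ⊎ MixedFirst m R)
  pathNC-suc⇔ {m = m} R = mk⇔ to from
    where
    to : PathNC (suc m) R → RealFirst m R ⊎ MixedFirst m R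
    to pnc with FP.any? (λ l → (suc m ℕ.≤? toℕ l) ×-dec sameBlock? R zero l)
    ... | yes mixed = inj₂ (pnc , mixed)
    ... | no ¬mixed = inj₁ (pnc , λ l m≤l h → ¬mixed (l , m≤l , h))

    from : RealFirst m R ⊎ MixedFirst m R → PathNC (suc m) R
    from (inj₁ (pnc , _)) = pnc
    from (inj₂ (pnc , _)) = pnc

  join-last≢join-first : ∀ {k m} {R₀ R₁ : RelMat (suc k)} → MixedFirst m R₀ → RealFirst m R₁ →
                         Back.insert (just (fromℕ k)) R₀ ≢ Back.insert (just zero) R₁
  join-last≢join-first {k} {m} {R₀} {R₁} ((P₀ , _) , mixed₀) (_ , real₁) eq =
    real₁ (fromℕ k) (subst (suc m ℕ.≤_) (sym (FP.toℕ-fromℕ k)) (firstBlockMixed⇒≤ {R = R₀} mixed₀))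
          (Back.join-new-old⁻ zero R₁ (subst (λ R → SameBlock R (fromℕ (suc k)) (inject₁ (fromℕ k))) eq
                                              (Back.join-new-old⁺ (fromℕ k) R₀ (IsPartition.refl P₀ (fromℕ k)))))

module Counting where

  open import Defs
  open Partition
  open PathPartition
  open import Data.Nat using (ℕ; zero; suc; _+_)
  import Data.Nat.Properties as ℕP
  open import Data.Fin as F using (fromℕ)
  import Data.Vec as Vec
  open import Data.List using ([]; _∷_; map; _++_)
  import Data.List.Properties as Listₚ
  open import Data.List.Membership.Propositional using (_∈_)
  open import Data.List.Membership.Propositional.Properties using (∈-map⁺; ∈-map⁻; ∈-++⁺ˡ; ∈-++⁺ʳ; ∈-++⁻)
  open import Data.List.Relation.Unary.Any using (here)
  import Data.List.Relation.Unary.All as All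
  import Data.List.Relation.Unary.AllPairs as AllPairs
  import Data.List.Relation.Unary.Unique.Propositional.Properties as Uniqueₚ
  open import Data.Product using (_,_)
  open import Data.Sum using (_⊎_; inj₁; inj₂)
  open import Data.Maybe using (just; nothing)
  open import Relation.Nullary using (¬_; contradiction)
  open import Relation.Binary.PropositionalEquality
  open import Function.Bundles using (_⇔_; mk⇔; Equivalence)
  import Function.Properties.Equivalence as ⇔

  hasCard-⇔ : ∀ {k} {P Q : RelMat k → Set} {c} → (∀ R → P R ⇔ Q R) → HasCard Q c → HasCard P c
  hasCard-⇔ P⇔Q (L , unique , length≡ , ∈⇔) = L , unique , length≡ , λ R → ⇔.trans (∈⇔ R) (⇔.sym (P⇔Q R))

  hasCard-RelMat0 : {P : RelMat 0 → Set} → (∀ R → P R) → HasCard P 1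
  hasCard-RelMat0 all =
    Vec.[] ∷ [] , All.[] AllPairs.∷ AllPairs.[] , refl , λ { Vec.[] → mk⇔ (λ _ → all Vec.[]) (λ _ → here refl) }

  hasCard-∅ : ∀ {k} {P : RelMat k → Set} → (∀ R → ¬ P R) → HasCard P 0
  hasCard-∅ none = [] , AllPairs.[] , refl , λ R → mk⇔ (λ ()) (λ p → contradiction p (none R))

  hasCard-⊎ : ∀ {k} {P Q : RelMat k → Set} {a b} → HasCard P a → HasCard Q b → (∀ {R} → P R → ¬ Q R) →
              HasCard (λ R → P R ⊎ Q R) (a + b)
  hasCard-⊎ {P = P} {Q} (L , L-unique , refl , ∈L) (M , M-unique , refl , ∈M) disjoint =
    L ++ M , Uniqueₚ.++⁺ L-unique M-unique (λ (r , r′) → disjoint (to (∈L _) r) (to (∈M _) r′)) ,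
    Listₚ.length-++ L , λ R → mk⇔ (sound R) (complete R)
    where
    open Equivalence

    sound : ∀ R → R ∈ L ++ M → P R ⊎ Q R
    sound R r with ∈-++⁻ L r
    ... | inj₁ r∈L = inj₁ (to (∈L R) r∈L)
    ... | inj₂ r∈M = inj₂ (to (∈M R) r∈M)

    complete : ∀ R → P R ⊎ Q R → R ∈ L ++ M
    complete R (inj₁ p) = ∈-++⁺ˡ (from (∈L R) p)
    complete R (inj₂ q) = ∈-++⁺ʳ L (from (∈M R) q)

  hasCard-image : ∀ {k k′} {P : RelMat k → Set} {a} (f : RelMat k → RelMat k′) → (∀ {R R′} → f R ≡ f R′ → R ≡ R′) →
                  HasCard P a → HasCard (Image f P) a
  hasCard-image {P = P} f f-injective (L , L-unique , refl , ∈L) =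
    map f L , Uniqueₚ.map⁺ f-injective L-unique , Listₚ.length-map f L , λ R → mk⇔ (sound R) (complete R)
    where
    open Equivalence

    sound : ∀ R → R ∈ map f L → Image f P R
    sound R r with ∈-map⁻ f r
    ... | R₀ , r₀ , R≡fR₀ = R₀ , to (∈L R₀) r₀ , R≡fR₀

    complete : ∀ R → Image f P R → R ∈ map f L
    complete _ (R₀ , p , refl) = ∈-map⁺ f (from (∈L R₀) p)

  images-disjoint : ∀ {k k′} {f g : RelMat k → RelMat k′} {A B : RelMat k → Set} →
                    (∀ {R₀ R₁} → A R₀ → B R₁ → f R₀ ≢ g R₁) → ∀ {R} → Image f A R → ¬ Image g B R
  images-disjoint f≢g (_ , a , refl) (_ , b , eq) = f≢g a b eq

  mutual
    ncCount : ℕ → ℕ → ℕ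
    ncCount zero    zero          = 1
    ncCount zero    (suc zero)    = 1
    ncCount zero    (suc (suc n)) = ncCount zero (suc n) + ncCount zero (suc n)
    ncCount (suc m) n             = realFirstCount m n + mixedFirstCount m n

    realFirstCount : ℕ → ℕ → ℕ
    realFirstCount zero    n = ncCount zero n
    realFirstCount (suc m) n = ncCount (suc m) n + realFirstCount m n

    mixedFirstCount : ℕ → ℕ → ℕ
    mixedFirstCount m zero    = 0
    mixedFirstCount m (suc n) = mixedFirstCount m n + (mixedFirstCount m n + realFirstCount m n)

  mutual
    pathNC-hasCard : ∀ m n → HasCard (PathNC {m + n} m) (ncCount m n)
    pathNC-hasCard zero zero = hasCard-RelMat0 pathNC-RelMat0
    pathNC-hasCard zero (suc zero) =
      hasCard-⇔ pathNC₀-one⇔ (hasCard-image (Back.insert nothing) (Back.insert-injective nothing) (pathNC-hasCard zero zero))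
    pathNC-hasCard zero (suc (suc n)) =
      hasCard-⇔ pathNC₀-suc⇔
        (hasCard-⊎ (hasCard-image (Back.insert nothing) (Back.insert-injective nothing) (pathNC-hasCard zero (suc n)))
                   (hasCard-image (Back.insert (just (fromℕ n))) (Back.insert-injective (just (fromℕ n)))
                                  (pathNC-hasCard zero (suc n)))
                   (images-disjoint (λ {R₀} _ (P₁ , _) → Back.insert-alone≢join {R₀ = R₀} P₁)))
    pathNC-hasCard (suc m) n =
      hasCard-⇔ pathNC-suc⇔
        (hasCard-⊎ (realFirst-hasCard m n) (mixedFirst-hasCard m n) (λ (_ , real) (_ , l , m≤l , 0∼l) → real l m≤l 0∼l))

    realFirst-hasCard : ∀ m n → HasCard (RealFirst {m + n} m) (realFirstCount m n)
    realFirst-hasCard zero n =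
      hasCard-⇔ realFirst-zero⇔
        (hasCard-image (Front.insert nothing) (Front.insert-injective nothing) (pathNC-hasCard zero n))
    realFirst-hasCard (suc m) n =
      hasCard-⇔ realFirst-suc⇔
        (hasCard-⊎ (hasCard-image (Front.insert nothing) (Front.insert-injective nothing) (pathNC-hasCard (suc m) n))
                   (hasCard-image (Front.insert (just F.zero)) (Front.insert-injective (just F.zero))
                                  (realFirst-hasCard m n))
                   (images-disjoint (λ {R₀} _ ((P₁ , _) , _) → Front.insert-alone≢join {R₀ = R₀} P₁)))

    mixedFirst-hasCard : ∀ m n → HasCard (MixedFirst {m + n} m) (mixedFirstCount m n)
    mixedFirst-hasCard m zero =
      hasCard-∅ (λ R (_ , mixed) → ℕP.<-irrefl (sym (ℕP.+-identityʳ m)) (firstBlockMixed⇒≤ {R = R} mixed))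
    mixedFirst-hasCard m (suc n) =
      subst (λ k → HasCard (MixedFirst {k} m) (mixedFirstCount m (suc n))) (sym (ℕP.+-suc m n))
        (hasCard-⇔ (mixedFirst-suc⇔ (ℕP.m≤m+n m n))
          (hasCard-⊎ alone (hasCard-⊎ join-last join-first (images-disjoint join-last≢join-first)) alone≁join))
      where
      alone≁join : ∀ {R} → Image (Back.insert nothing) (MixedFirst m) R →
                   ¬ (Image (Back.insert (just (fromℕ (m + n)))) (MixedFirst m) R ⊎
                      Image (Back.insert (just F.zero)) (RealFirst m) R)
      alone≁join img (inj₁ img′) = images-disjoint (λ {R₀} _ ((P₁ , _) , _) → Back.insert-alone≢join {R₀ = R₀} P₁) img img′
      alone≁join img (inj₂ img′) = images-disjoint (λ {R₀} _ ((P₁ , _) , _) → Back.insert-alone≢join {R₀ = R₀} P₁) img img′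

      alone = hasCard-image (Back.insert nothing) (Back.insert-injective nothing) (mixedFirst-hasCard m n)
      join-last = hasCard-image (Back.insert (just (fromℕ (m + n)))) (Back.insert-injective (just (fromℕ (m + n))))
                                (mixedFirst-hasCard m n)
      join-first = hasCard-image (Back.insert (just F.zero)) (Back.insert-injective (just F.zero)) (realFirst-hasCard m n)

module GeneratingFunction where

  open import Defs
  open Counting using (ncCount; realFirstCount; mixedFirstCount)
  open import Data.Nat as ℕ using (ℕ; zero; suc)
  open import Data.Integer as ℤ using (ℤ; +_; -[1+_])
  import Data.Integer.Properties as ℤP
  import Data.Nat.Tactic.RingSolver as ℕ-Solver
  import Data.Integer.Tactic.RingSolver as ℤ-Solver
  open import Data.Product using (_×_; _,_)
  open import Relation.Nullary using (¬_; contradiction)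
  open import Relation.Binary.PropositionalEquality

  sumTo-zero : ∀ n (g : ℕ → ℤ) → (∀ j → g j ≡ + 0) → sumTo n g ≡ + 0
  sumTo-zero zero    g g≡0 = g≡0 0
  sumTo-zero (suc n) g g≡0 = cong₂ ℤ._+_ (sumTo-zero n g g≡0) (g≡0 (suc n))

  sumTo-first-two : ∀ n (g : ℕ → ℤ) → (∀ j → g (suc (suc j)) ≡ + 0) → sumTo (suc n) g ≡ g 0 ℤ.+ g 1
  sumTo-first-two zero    g _     = refl
  sumTo-first-two (suc n) g g≡0 = trans (cong₂ ℤ._+_ (sumTo-first-two n g g≡0) (g≡0 n)) (ℤP.+-identityʳ _)

  module _ (f : Series) where

    denom⊛-suc-suc : ∀ m n → (denom ⊛ f) (suc m) (suc n) ≡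
                     (+ 1 ℤ.* f (suc m) (suc n) ℤ.+ -[1+ 1 ] ℤ.* f (suc m) n) ℤ.+
                     (-[1+ 1 ] ℤ.* f m (suc n) ℤ.+ + 3 ℤ.* f m n)
    denom⊛-suc-suc m n = trans (sumTo-first-two m _ (λ _ → sumTo-zero (suc n) _ (λ _ → refl)))
                               (cong₂ ℤ._+_ (sumTo-first-two n _ (λ _ → refl)) (sumTo-first-two n _ (λ _ → refl)))

    denom⊛-suc-zero : ∀ m → (denom ⊛ f) (suc m) zero ≡ + 1 ℤ.* f (suc m) zero ℤ.+ -[1+ 1 ] ℤ.* f m zero
    denom⊛-suc-zero m = sumTo-first-two m _ (λ _ → refl)

    denom⊛-zero-suc : ∀ n → (denom ⊛ f) zero (suc n) ≡ + 1 ℤ.* f zero (suc n) ℤ.+ -[1+ 1 ] ℤ.* f zero n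
    denom⊛-zero-suc n = sumTo-first-two n _ (λ _ → refl)

  -- The hypotheses are the identities over ℕ, with the negative terms moved to the other side.
  recurrence-ℤ : ∀ (a b c d : ℕ) → a ℕ.+ 3 ℕ.* d ≡ 2 ℕ.* b ℕ.+ 2 ℕ.* c →
                 (+ 1 ℤ.* + a ℤ.+ -[1+ 1 ] ℤ.* + b) ℤ.+ (-[1+ 1 ] ℤ.* + c ℤ.+ + 3 ℤ.* + d) ≡ + 0
  recurrence-ℤ a b c d eq = begin
    (+ 1 ℤ.* + a ℤ.+ -[1+ 1 ] ℤ.* + b) ℤ.+ (-[1+ 1 ] ℤ.* + c ℤ.+ + 3 ℤ.* + d)
      ≡⟨ regroup (+ a) (+ b) (+ c) (+ d) ⟩
    (+ a ℤ.+ + 3 ℤ.* + d) ℤ.- (+ 2 ℤ.* + b ℤ.+ + 2 ℤ.* + c)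
      ≡⟨ cong₂ ℤ._-_ (cong (ℤ._+_ (+ a)) (sym (ℤP.pos-* 3 d))) (cong₂ ℤ._+_ (sym (ℤP.pos-* 2 b)) (sym (ℤP.pos-* 2 c))) ⟩
    + (a ℕ.+ 3 ℕ.* d) ℤ.- + (2 ℕ.* b ℕ.+ 2 ℕ.* c)
      ≡⟨ cong (λ t → + t ℤ.- + (2 ℕ.* b ℕ.+ 2 ℕ.* c)) eq ⟩
    + (2 ℕ.* b ℕ.+ 2 ℕ.* c) ℤ.- + (2 ℕ.* b ℕ.+ 2 ℕ.* c)
      ≡⟨ ℤP.+-inverseʳ (+ (2 ℕ.* b ℕ.+ 2 ℕ.* c)) ⟩
    + 0
      ∎
    where
    open ≡-Reasoning
    regroup : ∀ x y z w → (+ 1 ℤ.* x ℤ.+ -[1+ 1 ] ℤ.* y) ℤ.+ (-[1+ 1 ] ℤ.* z ℤ.+ + 3 ℤ.* w) ≡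
                          (x ℤ.+ + 3 ℤ.* w) ℤ.- (+ 2 ℤ.* y ℤ.+ + 2 ℤ.* z)
    regroup = ℤ-Solver.solve-∀

  doubling-ℤ : ∀ (a b : ℕ) → a ≡ 2 ℕ.* b → + 1 ℤ.* + a ℤ.+ -[1+ 1 ] ℤ.* + b ≡ + 0
  doubling-ℤ a b eq = begin
    + 1 ℤ.* + a ℤ.+ -[1+ 1 ] ℤ.* + b ≡⟨ regroup (+ a) (+ b) ⟩
    + a ℤ.- + 2 ℤ.* + b              ≡⟨ cong₂ ℤ._-_ (cong +_ eq) (sym (ℤP.pos-* 2 b)) ⟩
    + (2 ℕ.* b) ℤ.- + (2 ℕ.* b)      ≡⟨ ℤP.+-inverseʳ (+ (2 ℕ.* b)) ⟩
    + 0                              ∎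
    where
    open ≡-Reasoning
    regroup : ∀ x y → + 1 ℤ.* x ℤ.+ -[1+ 1 ] ℤ.* y ≡ x ℤ.- + 2 ℤ.* y
    regroup = ℤ-Solver.solve-∀

  u : ℕ → ℕ → ℕ
  u zero    zero    = 0
  u zero    (suc n) = ncCount zero (suc n)
  u (suc m) n       = ncCount (suc m) n

  u≡ncCount : ∀ m n → ¬ (m ≡ 0 × n ≡ 0) → u m n ≡ ncCount m n
  u≡ncCount zero    zero    not00 = contradiction (refl , refl) not00
  u≡ncCount zero    (suc n) _     = refl
  u≡ncCount (suc m) n       _     = refl

  u-recurrence : ∀ m n → ¬ (m ≡ 0 × n ≡ 0) →
                 u (suc m) (suc n) ℕ.+ 3 ℕ.* u m n ≡ 2 ℕ.* u (suc m) n ℕ.+ 2 ℕ.* u m (suc n)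
  u-recurrence zero zero not00 = contradiction (refl , refl) not00
  u-recurrence zero (suc n) _ = identity (ncCount zero (suc n)) (mixedFirstCount zero (suc n))
    where
    identity : ∀ w q → ((w ℕ.+ w) ℕ.+ (q ℕ.+ (q ℕ.+ w))) ℕ.+ 3 ℕ.* w ≡ 2 ℕ.* (w ℕ.+ q) ℕ.+ 2 ℕ.* (w ℕ.+ w)
    identity = ℕ-Solver.solve-∀
  u-recurrence (suc m) n _ =
    identity (realFirstCount m n) (realFirstCount m (suc n)) (mixedFirstCount m n) (mixedFirstCount (suc m) n)
    where
    identity : ∀ p₀ p₁ q₀ q₁ →
      (((p₁ ℕ.+ (q₀ ℕ.+ (q₀ ℕ.+ p₀))) ℕ.+ p₁) ℕ.+ (q₁ ℕ.+ (q₁ ℕ.+ ((p₀ ℕ.+ q₀) ℕ.+ p₀)))) ℕ.+ 3 ℕ.* (p₀ ℕ.+ q₀)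
      ≡ 2 ℕ.* (((p₀ ℕ.+ q₀) ℕ.+ p₀) ℕ.+ q₁) ℕ.+ 2 ℕ.* (p₁ ℕ.+ (q₀ ℕ.+ (q₀ ℕ.+ p₀)))
    identity = ℕ-Solver.solve-∀

  u-doublingˣ : ∀ m → u (suc (suc m)) 0 ≡ 2 ℕ.* u (suc m) 0
  u-doublingˣ m = identity (realFirstCount m 0)
    where
    identity : ∀ p → ((p ℕ.+ 0) ℕ.+ p) ℕ.+ 0 ≡ 2 ℕ.* (p ℕ.+ 0)
    identity = ℕ-Solver.solve-∀

  u-doublingʸ : ∀ n → u 0 (suc (suc n)) ≡ 2 ℕ.* u 0 (suc n)
  u-doublingʸ n = identity (ncCount 0 (suc n))
    where
    identity : ∀ w → w ℕ.+ w ≡ 2 ℕ.* w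
    identity = ℕ-Solver.solve-∀

  uˢ : Series
  uˢ i j = + u i j

  denom⊛u-vanishes : ∀ m n → ¬ (m ≡ 0 × n ≡ 0) → (denom ⊛ uˢ) (suc m) (suc n) ≡ + 0
  denom⊛u-vanishes m n not00 =
    trans (denom⊛-suc-suc uˢ m n)
          (recurrence-ℤ (u (suc m) (suc n)) (u (suc m) n) (u m (suc n)) (u m n) (u-recurrence m n not00))

  u-generatingFunction : ∀ m n → (denom ⊛ (λ i j → + u i j)) m n ≡ numer m n
  u-generatingFunction zero          zero          = refl
  u-generatingFunction zero          (suc zero)    = denom⊛-zero-suc uˢ 0
  u-generatingFunction zero          (suc (suc n)) =
    trans (denom⊛-zero-suc uˢ (suc n)) (doubling-ℤ (u 0 (suc (suc n))) (u 0 (suc n)) (u-doublingʸ n))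
  u-generatingFunction (suc zero)    zero          = denom⊛-suc-zero uˢ 0
  u-generatingFunction (suc (suc m)) zero          =
    trans (denom⊛-suc-zero uˢ (suc m)) (doubling-ℤ (u (suc (suc m)) 0) (u (suc m) 0) (u-doublingˣ m))
  u-generatingFunction (suc zero)    (suc zero)    = denom⊛-suc-suc uˢ 0 0
  u-generatingFunction (suc zero)    (suc (suc n)) = denom⊛u-vanishes 0 (suc n) (λ ())
  u-generatingFunction (suc (suc m)) (suc n)       = denom⊛u-vanishes (suc m) n (λ ())

module ConvexHull where

  open import Defs
  open import Data.Nat using (ℕ; zero; suc)
  open import Data.Fin as F using (Fin; zero; suc)
  import Data.Fin.Properties as FP
  open import Data.Rational as ℚ using (ℚ; 0ℚ; 1ℚ; _+_; _*_; _-_; _<_; _≤_; -_)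
  import Data.Rational.Properties as ℚP
  open import Data.Rational.Solver using (module +-*-Solver)
  open import Data.Product using (Σ; ∃-syntax; _×_; _,_; proj₁; proj₂)
  open import Data.Sum using (_⊎_; inj₁; inj₂)
  open import Data.Unit using (⊤; tt)
  open import Relation.Nullary using (¬_; yes; no; contradiction)
  open import Relation.Unary using (Decidable)
  open import Relation.Binary.PropositionalEquality
  open import Relation.Binary.Definitions using (tri<; tri≈; tri>)
  open +-*-Solver

  *-nonNeg : ∀ {a b} → 0ℚ ≤ a → 0ℚ ≤ b → 0ℚ ≤ a * b
  *-nonNeg {a} {b} 0≤a 0≤b =
    ℚP.nonNegative⁻¹ (a * b) {{ℚP.nonNeg*nonNeg⇒nonNeg a {{ℚ.nonNegative 0≤a}} b {{ℚ.nonNegative 0≤b}}}}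

  *-monoʳ-<-0< : ∀ {c a b} → 0ℚ < c → a < b → c * a < c * b
  *-monoʳ-<-0< {c} 0<c = ℚP.*-monoʳ-<-pos c {{ℚ.positive 0<c}}

  *-monoʳ-≤-0≤ : ∀ {c a b} → 0ℚ ≤ c → a ≤ b → c * a ≤ c * b
  *-monoʳ-≤-0≤ {c} 0≤c = ℚP.*-monoˡ-≤-nonNeg c {{ℚ.nonNegative 0≤c}}

  <⇒0<- : ∀ {a b} → a < b → 0ℚ < b - a
  <⇒0<- {a} {b} a<b = subst (_< b - a) (ℚP.+-inverseʳ a) (ℚP.+-monoˡ-< (- a) a<b)

  ≤⇒0≤- : ∀ {a b} → a ≤ b → 0ℚ ≤ b - a
  ≤⇒0≤- {a} {b} a≤b = subst (_≤ b - a) (ℚP.+-inverseʳ a) (ℚP.+-monoˡ-≤ (- a) a≤b)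

  0≤∧≢0⇒0< : ∀ {x} → 0ℚ ≤ x → x ≢ 0ℚ → 0ℚ < x
  0≤∧≢0⇒0< {x} 0≤x x≢0 with ℚP.<-cmp 0ℚ x
  ... | tri< 0<x _ _ = 0<x
  ... | tri≈ _ 0≡x _ = contradiction (sym 0≡x) x≢0
  ... | tri> _ _ x<0 = contradiction (ℚP.<-≤-trans x<0 0≤x) (ℚP.<-irrefl refl)

  neg-cancel-< : ∀ {x y} → - x < - y → y < x
  neg-cancel-< {x} {y} -x<-y = subst₂ _<_ (neg-involutive y) (neg-involutive x) (ℚP.neg-antimono-< -x<-y)
    where
    neg-involutive : ∀ z → - (- z) ≡ z
    neg-involutive = solve 1 (λ z → :- (:- z) := z) refl

  inverse : (d : ℚ) → 0ℚ < d → ℚ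
  inverse d 0<d = ℚ.1/_ d {{ℚP.pos⇒nonZero d {{ℚ.positive 0<d}}}}

  *-inverse : ∀ d (0<d : 0ℚ < d) → d * inverse d 0<d ≡ 1ℚ
  *-inverse d 0<d = ℚP.*-inverseʳ d {{ℚP.pos⇒nonZero d {{ℚ.positive 0<d}}}}

  inverse-nonNeg : ∀ d (0<d : 0ℚ < d) → 0ℚ ≤ inverse d 0<d
  inverse-nonNeg d 0<d = ℚP.<⇒≤ (ℚP.positive⁻¹ _ {{ℚP.1/pos⇒pos d {{ℚ.positive 0<d}}}})

  sumℚ-cong : ∀ {k} {f g : Fin k → ℚ} → (∀ l → f l ≡ g l) → sumℚ f ≡ sumℚ g
  sumℚ-cong {zero}  f≡g = refl
  sumℚ-cong {suc k} f≡g = cong₂ _+_ (f≡g zero) (sumℚ-cong (λ l → f≡g (suc l)))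

  sumℚ-+ : ∀ {k} (f g : Fin k → ℚ) → sumℚ (λ l → f l + g l) ≡ sumℚ f + sumℚ g
  sumℚ-+ {zero}  f g = refl
  sumℚ-+ {suc k} f g =
    trans (cong (f zero + g zero +_) (sumℚ-+ (λ l → f (suc l)) (λ l → g (suc l))))
          (solve 4 (λ a b c d → (a :+ b) :+ (c :+ d) := (a :+ c) :+ (b :+ d)) refl
                 (f zero) (g zero) (sumℚ (λ l → f (suc l))) (sumℚ (λ l → g (suc l))))

  sumℚ-*ˡ : ∀ {k} (c : ℚ) (f : Fin k → ℚ) → sumℚ (λ l → c * f l) ≡ c * sumℚ f
  sumℚ-*ˡ {zero}  c f = sym (ℚP.*-zeroʳ c)
  sumℚ-*ˡ {suc k} c f = trans (cong (c * f zero +_) (sumℚ-*ˡ c (λ l → f (suc l)))) (sym (ℚP.*-distribˡ-+ c (f zero) _))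

  sumℚ-zero : ∀ {k} (f : Fin k → ℚ) → (∀ l → f l ≡ 0ℚ) → sumℚ f ≡ 0ℚ
  sumℚ-zero {zero}  f f≡0 = refl
  sumℚ-zero {suc k} f f≡0 = cong₂ _+_ (f≡0 zero) (sumℚ-zero (λ l → f (suc l)) (λ l → f≡0 (suc l)))

  sumℚ-mono-≤ : ∀ {k} {f g : Fin k → ℚ} → (∀ l → f l ≤ g l) → sumℚ f ≤ sumℚ g
  sumℚ-mono-≤ {zero}  f≤g = ℚP.≤-refl
  sumℚ-mono-≤ {suc k} f≤g = ℚP.+-mono-≤ (f≤g zero) (sumℚ-mono-≤ (λ l → f≤g (suc l)))

  sumℚ-mono-< : ∀ {k} {f g : Fin k → ℚ} → (∀ l → f l ≤ g l) → ∃[ l ] f l < g l → sumℚ f < sumℚ g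
  sumℚ-mono-< {suc k} f≤g (zero  , f<g) = ℚP.+-mono-<-≤ f<g (sumℚ-mono-≤ (λ l → f≤g (suc l)))
  sumℚ-mono-< {suc k} f≤g (suc l , f<g) = ℚP.+-mono-≤-< (f≤g zero) (sumℚ-mono-< (λ l → f≤g (suc l)) (l , f<g))

  sumℚ≡1⇒positive : ∀ {k} (w : Fin k → ℚ) → (∀ l → 0ℚ ≤ w l) → sumℚ w ≡ 1ℚ → ∃[ l ] 0ℚ < w l
  sumℚ≡1⇒positive w 0≤w Σw≡1 with FP.any? (λ l → 0ℚ ℚP.<? w l)
  ... | yes positive = positive
  ... | no  ¬positive = contradiction (trans (sym Σw≡1) (sumℚ-zero w w≡0)) ℚP.1≢0
    where
    w≡0 : ∀ l → w l ≡ 0ℚ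
    w≡0 l = ℚP.≤-antisym (ℚP.≮⇒≥ (λ 0<w → ¬positive (l , 0<w))) (0≤w l)

  pointMass : ∀ {k} → Fin k → ℚ → Fin k → ℚ
  pointMass zero    a zero    = a
  pointMass zero    a (suc l) = 0ℚ
  pointMass (suc p) a zero    = 0ℚ
  pointMass (suc p) a (suc l) = pointMass p a l

  pointMass-nonNeg : ∀ {k} (p : Fin k) {a} → 0ℚ ≤ a → ∀ l → 0ℚ ≤ pointMass p a l
  pointMass-nonNeg zero    0≤a zero    = 0≤a
  pointMass-nonNeg zero    0≤a (suc l) = ℚP.≤-refl
  pointMass-nonNeg (suc p) 0≤a zero    = ℚP.≤-refl
  pointMass-nonNeg (suc p) 0≤a (suc l) = pointMass-nonNeg p 0≤a l

  pointMass-≢ : ∀ {k} (p : Fin k) a l → l ≢ p → pointMass p a l ≡ 0ℚ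
  pointMass-≢ zero    a zero    l≢p = contradiction refl l≢p
  pointMass-≢ zero    a (suc l) l≢p = refl
  pointMass-≢ (suc p) a zero    l≢p = refl
  pointMass-≢ (suc p) a (suc l) l≢p = pointMass-≢ p a l (λ l≡p → l≢p (cong suc l≡p))

  sumℚ-pointMass-* : ∀ {k} (p : Fin k) a (g : Fin k → ℚ) → sumℚ (λ l → pointMass p a l * g l) ≡ a * g p
  sumℚ-pointMass-* zero a g =
    trans (cong (a * g zero +_) (sumℚ-zero _ (λ l → ℚP.*-zeroˡ (g (suc l))))) (ℚP.+-identityʳ _)
  sumℚ-pointMass-* (suc p) a g =
    trans (cong₂ _+_ (ℚP.*-zeroˡ (g zero)) (sumℚ-pointMass-* p a (λ l → g (suc l)))) (ℚP.+-identityˡ _)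

  sumℚ-pointMass : ∀ {k} (p : Fin k) a → sumℚ (pointMass p a) ≡ a
  sumℚ-pointMass p a =
    trans (sumℚ-cong (λ l → sym (ℚP.*-identityʳ (pointMass p a l))))
          (trans (sumℚ-pointMass-* p a (λ _ → 1ℚ)) (ℚP.*-identityʳ a))

  record Weights₂ : Set where
    field
      s t   : ℚ
      0≤s   : 0ℚ ≤ s
      0≤t   : 0ℚ ≤ t
      s+t≡1 : s + t ≡ 1ℚ

  combine : Weights₂ → Point → Point → Point
  combine w P Q = s * proj₁ P + t * proj₁ Q , s * proj₂ P + t * proj₂ Q
    where open Weights₂ w

  s·0+t·0≡0 : ∀ s t → s * 0ℚ + t * 0ℚ ≡ 0ℚ
  s·0+t·0≡0 = solve 2 (λ s t → s :* con 0ℚ :+ t :* con 0ℚ := con 0ℚ) refl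

  combine-on-real-axis : ∀ w {a b c} → Weights₂.s w * a + Weights₂.t w * c ≡ b → combine w (a , 0ℚ) (c , 0ℚ) ≡ (b , 0ℚ)
  combine-on-real-axis w eq = cong₂ _,_ eq (s·0+t·0≡0 (Weights₂.s w) (Weights₂.t w))

  combine-on-imag-axis : ∀ w {a b c} → Weights₂.s w * a + Weights₂.t w * c ≡ b → combine w (0ℚ , a) (0ℚ , c) ≡ (0ℚ , b)
  combine-on-imag-axis w eq = cong₂ _,_ (s·0+t·0≡0 (Weights₂.s w) (Weights₂.t w)) eq

  dot : Point → Point → ℚ
  dot v P = proj₁ v * proj₁ P + proj₂ v * proj₂ P

  module _ {k : ℕ} (p : Fin k → Point) (R : RelMat k) where

    inHull-combine : ∀ {i a b} → SameBlock R i a → SameBlock R i b → (w : Weights₂) →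
                     InHullOfBlock p R i (combine w (p a) (p b))
    inHull-combine {i} {a} {b} i∼a i∼b w = λ′ , 0≤λ′ , support , Σλ′≡1 , along proj₁ , along proj₂
      where
      open Weights₂ w
      λ′ : Fin k → ℚ
      λ′ l = pointMass a s l + pointMass b t l

      0≤λ′ : ∀ l → 0ℚ ≤ λ′ l
      0≤λ′ l = ℚP.+-mono-≤ (pointMass-nonNeg a 0≤s l) (pointMass-nonNeg b 0≤t l)

      support : ∀ l → λ′ l ≢ 0ℚ → SameBlock R i l
      support l λ′≢0 with l F.≟ a | l F.≟ b
      ... | yes refl | _        = i∼a
      ... | no _     | yes refl = i∼b
      ... | no l≢a   | no l≢b   = contradiction (cong₂ _+_ (pointMass-≢ a s l l≢a) (pointMass-≢ b t l l≢b)) λ′≢0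

      Σλ′≡1 : sumℚ λ′ ≡ 1ℚ
      Σλ′≡1 = trans (sumℚ-+ (pointMass a s) (pointMass b t))
                    (trans (cong₂ _+_ (sumℚ-pointMass a s) (sumℚ-pointMass b t)) s+t≡1)

      along : (π : Point → ℚ) → sumℚ (λ l → λ′ l * π (p l)) ≡ s * π (p a) + t * π (p b)
      along π = trans (sumℚ-cong (λ l → ℚP.*-distribʳ-+ (π (p l)) (pointMass a s l) (pointMass b t l)))
                      (trans (sumℚ-+ (λ l → pointMass a s l * π (p l)) (λ l → pointMass b t l * π (p l)))
                             (cong₂ _+_ (sumℚ-pointMass-* a s (λ l → π (p l))) (sumℚ-pointMass-* b t (λ l → π (p l)))))

    inHull-self : ∀ {i} a → SameBlock R i a → InHullOfBlock p R i (p a)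
    inHull-self a i∼a = subst (InHullOfBlock p R _) (cong₂ _,_ (1·x+0·x≡x _) (1·x+0·x≡x _)) (inHull-combine i∼a i∼a unit)
      where
      unit : Weights₂
      unit = record { s = 1ℚ ; t = 0ℚ ; 0≤s = ℚP.<⇒≤ (ℚP.positive⁻¹ 1ℚ) ; 0≤t = ℚP.≤-refl ; s+t≡1 = refl }
      1·x+0·x≡x : ∀ x → 1ℚ * x + 0ℚ * x ≡ x
      1·x+0·x≡x = solve 1 (λ x → con 1ℚ :* x :+ con 0ℚ :* x := x) refl

    private
      dot-hull : ∀ {i z} (H : InHullOfBlock p R i z) v → dot v z ≡ sumℚ (λ l → proj₁ H l * dot v (p l))
      dot-hull (λ′ , _ , _ , _ , Σx , Σy) (a , b) =
        trans (cong₂ (λ x y → a * x + b * y) (sym Σx) (sym Σy))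
        (trans (cong₂ _+_ (sym (sumℚ-*ˡ a (λ l → λ′ l * proj₁ (p l)))) (sym (sumℚ-*ˡ b (λ l → λ′ l * proj₂ (p l)))))
        (trans (sym (sumℚ-+ (λ l → a * (λ′ l * proj₁ (p l))) (λ l → b * (λ′ l * proj₂ (p l)))))
        (sumℚ-cong (λ l → solve 5 (λ w x y a b → a :* (w :* x) :+ b :* (w :* y) := w :* (a :* x :+ b :* y)) refl
                                  (λ′ l) (proj₁ (p l)) (proj₂ (p l)) a b))))

      sumℚ-weights-* : ∀ {i z} (H : InHullOfBlock p R i z) c → sumℚ (λ l → proj₁ H l * c) ≡ c
      sumℚ-weights-* (λ′ , _ , _ , Σλ′≡1 , _) c =
        trans (sumℚ-cong (λ l → ℚP.*-comm (λ′ l) c)) (trans (sumℚ-*ˡ c λ′) (trans (cong (c *_) Σλ′≡1) (ℚP.*-identityʳ c)))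

    inHull-dot-< : ∀ {i z} → InHullOfBlock p R i z → ∀ v c → (∀ l → SameBlock R i l → dot v (p l) < c) → dot v z < c
    inHull-dot-< H@(λ′ , 0≤λ′ , support , Σλ′≡1 , _) v c bound =
      subst₂ _<_ (sym (dot-hull H v)) (sumℚ-weights-* H c) (sumℚ-mono-< termwise strict)
      where
      termwise : ∀ l → λ′ l * dot v (p l) ≤ λ′ l * c
      termwise l with λ′ l ℚP.≟ 0ℚ
      ... | yes λ′≡0 = subst (λ w → w * dot v (p l) ≤ w * c) (sym λ′≡0)
                             (subst₂ _≤_ (sym (ℚP.*-zeroˡ (dot v (p l)))) (sym (ℚP.*-zeroˡ c)) ℚP.≤-refl)
      ... | no  λ′≢0 = ℚP.<⇒≤ (*-monoʳ-<-0< (0≤∧≢0⇒0< (0≤λ′ l) λ′≢0) (bound l (support l λ′≢0)))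
      strict : ∃[ l ] λ′ l * dot v (p l) < λ′ l * c
      strict with sumℚ≡1⇒positive λ′ 0≤λ′ Σλ′≡1
      ... | l , 0<λ′ = l , *-monoʳ-<-0< 0<λ′ (bound l (support l (λ λ′≡0 → ℚP.<-irrefl (sym λ′≡0) 0<λ′)))

    inHull-dot-≥ : ∀ {i z} → InHullOfBlock p R i z → ∀ v c → (∀ l → SameBlock R i l → c ≤ dot v (p l)) → c ≤ dot v z
    inHull-dot-≥ H@(λ′ , 0≤λ′ , support , _ , _) v c bound =
      subst₂ _≤_ (sumℚ-weights-* H c) (sym (dot-hull H v)) (sumℚ-mono-≤ termwise)
      where
      termwise : ∀ l → λ′ l * c ≤ λ′ l * dot v (p l)
      termwise l with λ′ l ℚP.≟ 0ℚ
      ... | yes λ′≡0 = subst (λ w → w * c ≤ w * dot v (p l)) (sym λ′≡0)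
                             (subst₂ _≤_ (sym (ℚP.*-zeroˡ c)) (sym (ℚP.*-zeroˡ (dot v (p l)))) ℚP.≤-refl)
      ... | no  λ′≢0 = *-monoʳ-≤-0≤ (0≤λ′ l) (bound l (support l λ′≢0))

  between : ∀ {a b c} → a < b → b < c → Σ Weights₂ λ w → Weights₂.s w * a + Weights₂.t w * c ≡ b
  between {a} {b} {c} a<b b<c = w , combination
    where
    0<c-a = <⇒0<- (ℚP.<-trans a<b b<c)
    d = inverse (c - a) 0<c-a
    w : Weights₂
    w = record
      { s     = (c - b) * d
      ; t     = (b - a) * d
      ; 0≤s   = *-nonNeg (≤⇒0≤- (ℚP.<⇒≤ b<c)) (inverse-nonNeg _ 0<c-a)
      ; 0≤t   = *-nonNeg (≤⇒0≤- (ℚP.<⇒≤ a<b)) (inverse-nonNeg _ 0<c-a)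
      ; s+t≡1 = trans (solve 4 (λ a b c d → (c :- b) :* d :+ (b :- a) :* d := (c :- a) :* d) refl a b c d)
                      (*-inverse (c - a) 0<c-a)
      }
    combination : (c - b) * d * a + (b - a) * d * c ≡ b
    combination =
      trans (solve 4 (λ a b c d → ((c :- b) :* d) :* a :+ ((b :- a) :* d) :* c := b :* ((c :- a) :* d)) refl a b c d)
                        (trans (cong (b *_) (*-inverse (c - a) 0<c-a)) (ℚP.*-identityʳ b))

  -- The weights solve the linear system for the intersection point; D is its determinant.
  segments-cross : ∀ {P Q R S} → 0ℚ < Q → Q < P → 0ℚ < R → R < S →
                   Σ (Weights₂ × Weights₂) λ (w₁ , w₂) → combine w₁ (P , 0ℚ) (0ℚ , R) ≡ combine w₂ (Q , 0ℚ) (0ℚ , S)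
  segments-cross {P} {Q} {R} {S} 0<Q Q<P 0<R R<S = (w₁ , w₂) , cong₂ _,_ x-equal y-equal
    where
    0<S = ℚP.<-trans 0<R R<S
    QR<PS : Q * R < P * S
    QR<PS = ℚP.<-trans (*-monoʳ-<-0< 0<Q R<S) (subst₂ _<_ (ℚP.*-comm S Q) (ℚP.*-comm S P) (*-monoʳ-<-0< 0<S Q<P))
    D = P * S - Q * R
    0<D = <⇒0<- QR<PS
    d = inverse D 0<D
    0≤d = inverse-nonNeg D 0<D
    0≤S-R = ≤⇒0≤- (ℚP.<⇒≤ R<S)
    0≤P-Q = ≤⇒0≤- (ℚP.<⇒≤ Q<P)
    w₁ w₂ : Weights₂
    w₁ = record
      { s = Q * (S - R) * d ; t = (P - Q) * S * d
      ; 0≤s = *-nonNeg (*-nonNeg (ℚP.<⇒≤ 0<Q) 0≤S-R) 0≤d ; 0≤t = *-nonNeg (*-nonNeg 0≤P-Q (ℚP.<⇒≤ 0<S)) 0≤d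
      ; s+t≡1 = trans (solve 5 (λ P Q R S d → Q :* (S :- R) :* d :+ (P :- Q) :* S :* d := (P :* S :- Q :* R) :* d)
                               refl P Q R S d)
                      (*-inverse D 0<D)
      }
    w₂ = record
      { s = P * (S - R) * d ; t = (P - Q) * R * d
      ; 0≤s = *-nonNeg (*-nonNeg (ℚP.<⇒≤ (ℚP.<-trans 0<Q Q<P)) 0≤S-R) 0≤d ; 0≤t = *-nonNeg (*-nonNeg 0≤P-Q (ℚP.<⇒≤ 0<R)) 0≤d
      ; s+t≡1 = trans (solve 5 (λ P Q R S d → P :* (S :- R) :* d :+ (P :- Q) :* R :* d := (P :* S :- Q :* R) :* d)
                               refl P Q R S d)
                      (*-inverse D 0<D)
      }
    x-equal : Q * (S - R) * d * P + (P - Q) * S * d * 0ℚ ≡ P * (S - R) * d * Q + (P - Q) * R * d * 0ℚ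
    x-equal = solve 5 (λ P Q R S d → Q :* (S :- R) :* d :* P :+ (P :- Q) :* S :* d :* con 0ℚ
                                   := P :* (S :- R) :* d :* Q :+ (P :- Q) :* R :* d :* con 0ℚ) refl P Q R S d
    y-equal : Q * (S - R) * d * 0ℚ + (P - Q) * S * d * R ≡ P * (S - R) * d * 0ℚ + (P - Q) * R * d * S
    y-equal = solve 5 (λ P Q R S d → Q :* (S :- R) :* d :* con 0ℚ :+ (P :- Q) :* S :* d :* R
                                   := P :* (S :- R) :* d :* con 0ℚ :+ (P :- Q) :* R :* d :* S) refl P Q R S d

  minimumOn : ∀ {q} (f : Fin q → ℚ) {B : Fin q → Set} → Decidable B →
              (∀ a → ¬ B a) ⊎ ∃[ a₀ ] B a₀ × (∀ a → B a → f a₀ ≤ f a)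
  minimumOn {zero}  f B? = inj₁ λ ()
  minimumOn {suc q} f B? with minimumOn (λ a → f (suc a)) (λ a → B? (suc a)) | B? zero
  ... | inj₁ none               | no ¬b₀ = inj₁ λ { zero → ¬b₀ ; (suc a) → none a }
  ... | inj₁ none               | yes b₀ = inj₂ (zero , b₀ , λ { zero _ → ℚP.≤-refl ; (suc a) b → contradiction b (none a) })
  ... | inj₂ (a₀ , b₀′ , min)   | no ¬b₀ = inj₂ (suc a₀ , b₀′ , λ { zero b → contradiction b ¬b₀ ; (suc a) b → min a b })
  ... | inj₂ (a₀ , b₀′ , min)   | yes b₀ with ℚP.≤-total (f zero) (f (suc a₀))
  ...   | inj₁ f₀≤ = inj₂ (zero , b₀ , λ { zero _ → ℚP.≤-refl ; (suc a) b → ℚP.≤-trans f₀≤ (min a b) })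
  ...   | inj₂ ≥f₀ = inj₂ (suc a₀ , b₀′ , λ { zero _ → ≥f₀ ; (suc a) b → min a b })

  argmin : ∀ {q} (f : Fin (suc q) → ℚ) → ∃[ a₀ ] ∀ a → f a₀ ≤ f a
  argmin f with minimumOn f {λ _ → ⊤} (λ _ → yes tt)
  ... | inj₁ none            = contradiction tt (none zero)
  ... | inj₂ (a₀ , _ , min) = a₀ , λ a → min a tt

  upperBound : ∀ {q} (f : Fin q → ℚ) → (∀ a → 0ℚ < f a) → ∃[ M ] 0ℚ < M × (∀ a → f a < M)
  upperBound {zero}  f 0<f = 1ℚ , ℚP.positive⁻¹ 1ℚ , λ ()
  upperBound {suc q} f 0<f with upperBound (λ a → f (suc a)) (λ a → 0<f (suc a))
  ... | M , 0<M , f<M = M + f zero , ℚP.<-trans 0<M M<M+f₀ , λ { zero → f₀<M+f₀ ; (suc a) → ℚP.<-trans (f<M a) M<M+f₀ }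
    where
    M<M+f₀ : M < M + f zero
    M<M+f₀ = subst (_< M + f zero) (ℚP.+-identityʳ M) (ℚP.+-monoʳ-< M (0<f zero))
    f₀<M+f₀ : f zero < M + f zero
    f₀<M+f₀ = subst (_< M + f zero) (ℚP.+-identityˡ (f zero)) (ℚP.+-monoˡ-< (f zero) 0<M)

  threshold : ∀ {q} (f : Fin q → ℚ) → (∀ a → 0ℚ < f a) → {A B : Fin q → Set} → Decidable B →
              (∀ a a′ → A a → B a′ → f a < f a′) →
              ∃[ α ] 0ℚ < α × (∀ a → A a → f a < α) × (∀ a → B a → α ≤ f a)
  threshold f 0<f B? A<B with minimumOn f B?
  ... | inj₂ (a₀ , b₀ , min) = f a₀ , 0<f a₀ , (λ a a∈A → A<B a a₀ a∈A b₀) , min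
  ... | inj₁ none with upperBound f 0<f
  ...   | M , 0<M , f<M = M , 0<M , (λ a _ → f<M a) , λ a b → contradiction b (none a)

module Sort where

  open import Data.Nat using (zero; suc; s≤s)
  open import Data.Fin as F using (Fin; zero; suc; punchIn; punchOut)
  import Data.Fin.Properties as FP
  open import Data.Rational using (ℚ; _<_)
  import Data.Rational.Properties as ℚP
  open import Data.Product using (_,_; proj₁; proj₂)
  open import Relation.Nullary using (yes; no; contradiction)
  open import Relation.Binary.PropositionalEquality
  open import Relation.Binary.Definitions using (tri<; tri≈; tri>)
  open ConvexHull using (argmin)

  record Sorting {m} (f : Fin m → ℚ) : Set where
    field
      at         : Fin m → Fin m
      rank       : Fin m → Fin m
      at-rank    : ∀ i → at (rank i) ≡ i
      rank-at    : ∀ a → rank (at a) ≡ a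
      increasing : ∀ {a b} → a F.< b → f (at a) < f (at b)

    rank-increasing : ∀ {i i′} → f i < f i′ → rank i F.< rank i′
    rank-increasing {i} {i′} fi<fi′ with FP.<-cmp (rank i) (rank i′)
    ... | tri< r<r′ _ _ = r<r′
    ... | tri≈ _ r≡r′ _ =
      contradiction (cong f (trans (sym (at-rank i)) (trans (cong at r≡r′) (at-rank i′)))) (ℚP.<⇒≢ fi<fi′)
    ... | tri> _ _ r′<r =
      contradiction (subst₂ _<_ (cong f (at-rank i′)) (cong f (at-rank i)) (increasing r′<r)) (ℚP.<-asym fi<fi′)

  -- Selection sort: the minimum gets rank 0 and the remaining points are ranked recursively.
  sort : ∀ {m} (f : Fin m → ℚ) → (∀ i j → f i ≡ f j → i ≡ j) → Sorting f
  sort {zero}  f f-injective = record { at = λ () ; rank = λ () ; at-rank = λ () ; rank-at = λ () ; increasing = λ { {()} } }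
  sort {suc m} f f-injective =
    record { at = at ; rank = rank ; at-rank = at-rank ; rank-at = rank-at ; increasing = increasing }
    where
    i₀ = proj₁ (argmin f)
    module Rest = Sorting (sort (λ j → f (punchIn i₀ j)) (λ i j eq → FP.punchIn-injective i₀ i j (f-injective _ _ eq)))

    at : Fin (suc m) → Fin (suc m)
    at zero    = i₀
    at (suc a) = punchIn i₀ (Rest.at a)

    rank : Fin (suc m) → Fin (suc m)
    rank i with i₀ FP.≟ i
    ... | yes _   = zero
    ... | no i₀≢i = suc (Rest.rank (punchOut i₀≢i))

    at-rank : ∀ i → at (rank i) ≡ i
    at-rank i with i₀ FP.≟ i
    ... | yes i₀≡i = i₀≡i
    ... | no  i₀≢i = trans (cong (punchIn i₀) (Rest.at-rank (punchOut i₀≢i))) (FP.punchIn-punchOut i₀≢i)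

    rank-at : ∀ a → rank (at a) ≡ a
    rank-at zero with i₀ FP.≟ i₀
    ... | yes _    = refl
    ... | no  i₀≢i₀ = contradiction refl i₀≢i₀
    rank-at (suc a) with i₀ FP.≟ punchIn i₀ (Rest.at a)
    ... | yes i₀≡ = contradiction (sym i₀≡) (FP.punchInᵢ≢i i₀ (Rest.at a))
    ... | no  i₀≢ =
      cong suc (trans (cong Rest.rank (trans (FP.punchOut-cong i₀ refl) (FP.punchOut-punchIn i₀))) (Rest.rank-at a))

    increasing : ∀ {a b} → a F.< b → f (at a) < f (at b)
    increasing {zero}  {suc b} _ with ℚP.<-cmp (f i₀) (f (punchIn i₀ (Rest.at b)))
    ... | tri< f₀<f _ _ = f₀<f
    ... | tri≈ _ f₀≡f _ = contradiction (sym (f-injective _ _ f₀≡f)) (FP.punchInᵢ≢i i₀ (Rest.at b))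
    ... | tri> _ _ f<f₀ = contradiction (ℚP.<-≤-trans f<f₀ (proj₂ (argmin f) _)) (ℚP.<-irrefl refl)
    increasing {suc a} {suc b} (s≤s a<b) = Rest.increasing a<b

module Configuration {m n} (U : Config m n) where

  open import Defs
  open Partition
  open ConvexHull
  open import Data.Nat as ℕ using (ℕ; _+_)
  import Data.Nat.Properties as ℕP
  open import Data.Fin as F using (Fin; _↑ˡ_; _↑ʳ_; splitAt)
  import Data.Fin.Properties as FP
  open import Data.Rational as ℚ using (ℚ; 0ℚ; _<_; _≤_; _*_; -_)
  import Data.Rational.Properties as ℚP
  open import Data.Rational.Solver using (module +-*-Solver)
  open import Data.Product using (Σ; _×_; _,_)
  open import Data.Sum using (_⊎_; inj₁; inj₂; [_,_]′)
  open import Relation.Nullary using (¬_; yes; no; contradiction; ¬?)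
  open import Relation.Nullary.Decidable using (_×-dec_; decidable-stable)
  open import Relation.Binary.PropositionalEquality
  open import Relation.Binary.Definitions using (tri<; tri≈; tri>)
  open import Function.Bundles using (_⇔_; mk⇔)
  open Config U
  open +-*-Solver

  real : Fin m → Fin (m + n)
  real i = i ↑ˡ n

  imag : Fin n → Fin (m + n)
  imag j = m ↑ʳ j

  point-real : ∀ i → point U (real i) ≡ (re i , 0ℚ)
  point-real i rewrite FP.splitAt-↑ˡ m i n = refl

  point-imag : ∀ j → point U (imag j) ≡ (0ℚ , im j)
  point-imag j rewrite FP.splitAt-↑ʳ m n j = refl

  data Side : Fin (m + n) → Set where
    onReal : ∀ i → Side (real i)
    onImag : ∀ j → Side (imag j)

  side : ∀ l → Side l
  side l with splitAt m l in eq
  ... | inj₁ i = subst Side (FP.splitAt⁻¹-↑ˡ eq) (onReal i)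
  ... | inj₂ j = subst Side (FP.splitAt⁻¹-↑ʳ eq) (onImag j)

  record AxisUncrossed (R : RelMat (m + n)) : Set where
    field
      intervalʳ  : ∀ {i₁ i₂ i₃} → re i₁ < re i₂ → re i₂ < re i₃ →
                   SameBlock R (real i₁) (real i₃) → SameBlock R (real i₁) (real i₂)
      intervalⁱ  : ∀ {j₁ j₂ j₃} → im j₁ < im j₂ → im j₂ < im j₃ →
                   SameBlock R (imag j₁) (imag j₃) → SameBlock R (imag j₁) (imag j₂)
      noCrossing : ∀ {i₁ i₂ j₁ j₂} → re i₂ < re i₁ → im j₁ < im j₂ →
                   SameBlock R (real i₁) (imag j₁) → SameBlock R (real i₂) (imag j₂) → SameBlock R (real i₁) (real i₂)

  module _ {R : RelMat (m + n)} (P : IsPartition R) where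

    private
      module P = IsPartition P
      open IsPartitionProperties P

      inHull-at : ∀ {a z} → point U a ≡ z → InHullOfBlock (point U) R a z
      inHull-at {a} pa≡z = subst (InHullOfBlock (point U) R a) pa≡z (inHull-self (point U) R a (P.refl a))

      inHull-between : ∀ {l a b A B z} → SameBlock R l a → SameBlock R l b → point U a ≡ A → point U b ≡ B →
                       (w : Weights₂) → combine w A B ≡ z → InHullOfBlock (point U) R l z
      inHull-between {l} l∼a l∼b pa≡A pb≡B w AB≡z =
        subst (InHullOfBlock (point U) R l) (trans (cong₂ (combine w) pa≡A pb≡B) AB≡z) (inHull-combine (point U) R l∼a l∼b w)

    noncrossing⇒axisUncrossed : IsNoncrossing (point U) R → AxisUncrossed R
    noncrossing⇒axisUncrossed noncrossing = record
      { intervalʳ = interval-real ; intervalⁱ = interval-imag ; noCrossing = no-crossing }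
      where
      interval-real : ∀ {i₁ i₂ i₃} → re i₁ < re i₂ → re i₂ < re i₃ →
                      SameBlock R (real i₁) (real i₃) → SameBlock R (real i₁) (real i₂)
      interval-real {i₁} {i₂} {i₃} r₁<r₂ r₂<r₃ h =
        decidable-stable (sameBlock? R (real i₁) (real i₂)) (λ ¬same → noncrossing _ _ ¬same (common (between r₁<r₂ r₂<r₃)))
        where
        common : Σ Weights₂ (λ w → Weights₂.s w * re i₁ ℚ.+ Weights₂.t w * re i₃ ≡ re i₂) →
                 Σ Point λ z → InHullOfBlock (point U) R (real i₁) z × InHullOfBlock (point U) R (real i₂) z
        common (w , combination) =
          (re i₂ , 0ℚ) ,
          inHull-between (P.refl (real i₁)) h (point-real i₁) (point-real i₃) w (combine-on-real-axis w combination) ,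
          inHull-at (point-real i₂)

      interval-imag : ∀ {j₁ j₂ j₃} → im j₁ < im j₂ → im j₂ < im j₃ →
                      SameBlock R (imag j₁) (imag j₃) → SameBlock R (imag j₁) (imag j₂)
      interval-imag {j₁} {j₂} {j₃} s₁<s₂ s₂<s₃ h =
        decidable-stable (sameBlock? R (imag j₁) (imag j₂)) (λ ¬same → noncrossing _ _ ¬same (common (between s₁<s₂ s₂<s₃)))
        where
        common : Σ Weights₂ (λ w → Weights₂.s w * im j₁ ℚ.+ Weights₂.t w * im j₃ ≡ im j₂) →
                 Σ Point λ z → InHullOfBlock (point U) R (imag j₁) z × InHullOfBlock (point U) R (imag j₂) z
        common (w , combination) =
          (0ℚ , im j₂) ,
          inHull-between (P.refl (imag j₁)) h (point-imag j₁) (point-imag j₃) w (combine-on-imag-axis w combination) ,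
          inHull-at (point-imag j₂)

      no-crossing : ∀ {i₁ i₂ j₁ j₂} → re i₂ < re i₁ → im j₁ < im j₂ →
                    SameBlock R (real i₁) (imag j₁) → SameBlock R (real i₂) (imag j₂) → SameBlock R (real i₁) (real i₂)
      no-crossing {i₁} {i₂} {j₁} {j₂} r₂<r₁ s₁<s₂ h₁ h₂ =
        decidable-stable (sameBlock? R (real i₁) (real i₂))
          (λ ¬same → noncrossing _ _ ¬same (common (segments-cross (re-pos i₂) r₂<r₁ (im-pos j₁) s₁<s₂)))
        where
        common : Σ (Weights₂ × Weights₂)
                   (λ (w₁ , w₂) → combine w₁ (re i₁ , 0ℚ) (0ℚ , im j₁) ≡ combine w₂ (re i₂ , 0ℚ) (0ℚ , im j₂)) →
                 Σ Point λ z → InHullOfBlock (point U) R (real i₁) z × InHullOfBlock (point U) R (real i₂) z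
        common ((w₁ , w₂) , meet) =
          combine w₁ (re i₁ , 0ℚ) (0ℚ , im j₁) ,
          inHull-between (P.refl (real i₁)) h₁ (point-real i₁) (point-imag j₁) w₁ refl ,
          inHull-between (P.refl (real i₂)) h₂ (point-real i₂) (point-imag j₂) w₂ (sym meet)

    Before : ∀ {q} → (Fin q → Fin (m + n)) → (Fin q → ℚ) → Fin (m + n) → Fin (m + n) → Set
    Before e f i j = ∀ a a′ → SameBlock R i (e a) → SameBlock R j (e a′) → f a < f a′

    axis-separated : ∀ {q} (e : Fin q → Fin (m + n)) (f : Fin q → ℚ) → (∀ a b → f a ≡ f b → a ≡ b) →
                     (∀ {a b c} → f a < f b → f b < f c → SameBlock R (e a) (e c) → SameBlock R (e a) (e b)) →
                     ∀ i j → ¬ SameBlock R i j → Before e f i j ⊎ Before e f j i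
    axis-separated e f f-injective interval i j i≁j
      with FP.any? (λ a → FP.any? (λ a′ → sameBlock? R i (e a) ×-dec sameBlock? R j (e a′) ×-dec ¬? (f a ℚP.<? f a′)))
    ... | no none = inj₁ λ a a′ i∼a j∼a′ → decidable-stable (f a ℚP.<? f a′) (λ ≮ → none (a , a′ , i∼a , j∼a′ , ≮))
    ... | yes (a , a′ , i∼a , j∼a′ , fa≮fa′) = inj₂ j-before-i
      where
      disjoint : ∀ {x} → SameBlock R i x → ¬ SameBlock R j x
      disjoint i∼x j∼x = i≁j (sameBlock-viaʳ i∼x j∼x)

      same-point : ∀ {b b′} → f b ≡ f b′ → SameBlock R j (e b) → SameBlock R j (e b′)
      same-point fb≡fb′ = subst (λ x → SameBlock R j (e x)) (f-injective _ _ fb≡fb′)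

      fa′<fa : f a′ < f a
      fa′<fa with ℚP.<-cmp (f a) (f a′)
      ... | tri< fa<fa′ _ _ = contradiction fa<fa′ fa≮fa′
      ... | tri≈ _ fa≡fa′ _ = contradiction (same-point (sym fa≡fa′) j∼a′) (disjoint i∼a)
      ... | tri> _ _ fa′<fa = fa′<fa

      j-before-i : Before e f j i
      j-before-i b′ b j∼b′ i∼b with ℚP.<-cmp (f b′) (f b)
      ... | tri< fb′<fb _ _ = fb′<fb
      ... | tri≈ _ fb′≡fb _ = contradiction (same-point fb′≡fb j∼b′) (disjoint i∼b)
      ... | tri> _ _ fb<fb′ with ℚP.<-cmp (f b′) (f a)
      ...   | tri< fb′<fa _ _ =
        contradiction j∼b′ (disjoint (P.trans _ _ _ i∼b (interval fb<fb′ fb′<fa (sameBlock-viaˡ i∼b i∼a))))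
      ...   | tri≈ _ fb′≡fa _ = contradiction (same-point fb′≡fa j∼b′) (disjoint i∼a)
      ...   | tri> _ _ fa<fb′ =
        contradiction (P.trans _ _ _ j∼a′ (interval fa′<fa fa<fb′ (sameBlock-viaˡ j∼a′ j∼b′))) (disjoint i∼a)

    Inside : Fin (m + n) → Fin (m + n) → Set
    Inside i j = Before real re i j × Before imag im i j

    -- Opposite orders on the two axes are only possible if one block misses an axis.
    inside-if-opposite : AxisUncrossed R → ∀ i j → ¬ SameBlock R i j → Before real re i j → Before imag im j i →
                         Inside i j ⊎ Inside j i
    inside-if-opposite A i j i≁j realᵢⱼ imagⱼᵢ
      with FP.any? (λ a → sameBlock? R i (real a)) | FP.any? (λ a → sameBlock? R j (real a))
         | FP.any? (λ b → sameBlock? R i (imag b)) | FP.any? (λ b → sameBlock? R j (imag b))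
    ... | no ¬realᵢ | _ | _ | _ = inj₂ ((λ a a′ _ i∼a′ → contradiction (a′ , i∼a′) ¬realᵢ) , imagⱼᵢ)
    ... | yes _ | no ¬realⱼ | _ | _ = inj₂ ((λ a a′ j∼a _ → contradiction (a , j∼a) ¬realⱼ) , imagⱼᵢ)
    ... | yes _ | yes _ | no ¬imagᵢ | _ = inj₁ (realᵢⱼ , λ b b′ i∼b _ → contradiction (b , i∼b) ¬imagᵢ)
    ... | yes _ | yes _ | yes _ | no ¬imagⱼ = inj₁ (realᵢⱼ , λ b b′ _ j∼b′ → contradiction (b′ , j∼b′) ¬imagⱼ)
    ... | yes (a , i∼a) | yes (a′ , j∼a′) | yes (b , i∼b) | yes (b′ , j∼b′) = contradiction
      (sameBlock-viaʳ i∼a (P.trans _ _ _ j∼a′ (AxisUncrossed.noCrossing A (realᵢⱼ a a′ i∼a j∼a′) (imagⱼᵢ b′ b j∼b′ i∼b)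
                                                  (sameBlock-viaˡ j∼a′ j∼b′) (sameBlock-viaˡ i∼a i∼b))))
      i≁j

    inside-either : AxisUncrossed R → ∀ i j → ¬ SameBlock R i j → Inside i j ⊎ Inside j i
    inside-either A i j i≁j
      with axis-separated real re re-inj (AxisUncrossed.intervalʳ A) i j i≁j
         | axis-separated imag im im-inj (AxisUncrossed.intervalⁱ A) i j i≁j
    ... | inj₁ realᵢⱼ | inj₁ imagᵢⱼ = inj₁ (realᵢⱼ , imagᵢⱼ)
    ... | inj₂ realⱼᵢ | inj₂ imagⱼᵢ = inj₂ (realⱼᵢ , imagⱼᵢ)
    ... | inj₁ realᵢⱼ | inj₂ imagⱼᵢ = inside-if-opposite A i j i≁j realᵢⱼ imagⱼᵢ
    ... | inj₂ realⱼᵢ | inj₁ imagᵢⱼ with inside-if-opposite A j i (λ j∼i → i≁j (P.sym _ _ j∼i)) realⱼᵢ imagᵢⱼ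
    ...   | inj₁ insideⱼᵢ = inj₂ insideⱼᵢ
    ...   | inj₂ insideᵢⱼ = inj₁ insideᵢⱼ

    -- With thresholds α on the real and β on the imaginary axis between the two blocks, the line
    -- β x + α y = α β separates them.
    inside-separated : ∀ i j → Inside i j → ∀ {z} → InHullOfBlock (point U) R i z → ¬ InHullOfBlock (point U) R j z
    inside-separated i j (realᵢⱼ , imagᵢⱼ) Hᵢ Hⱼ
      with threshold re re-pos (λ a → sameBlock? R j (real a)) realᵢⱼ
         | threshold im im-pos (λ b → sameBlock? R j (imag b)) imagᵢⱼ
    ... | α , 0<α , realᵢ<α , α≤realⱼ | β , 0<β , imagᵢ<β , β≤imagⱼ =
      ℚP.<-irrefl refl (ℚP.<-≤-trans (inHull-dot-< (point U) R Hᵢ v (α * β) inner)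
                                     (inHull-dot-≥ (point U) R Hⱼ v (α * β) outer))
      where
      v = (β , α)

      dot-real : ∀ x → dot v (x , 0ℚ) ≡ β * x
      dot-real x = solve 3 (λ x a b → b :* x :+ a :* con 0ℚ := b :* x) refl x α β

      dot-imag : ∀ y → dot v (0ℚ , y) ≡ α * y
      dot-imag y = solve 3 (λ y a b → b :* con 0ℚ :+ a :* y := a :* y) refl y α β

      inner : ∀ l → SameBlock R i l → dot v (point U l) < α * β
      inner l i∼l with side l
      ... | onReal a = subst (λ P → dot v P < α * β) (sym (point-real a))
                         (subst₂ _<_ (sym (dot-real (re a))) (ℚP.*-comm β α) (*-monoʳ-<-0< 0<β (realᵢ<α a i∼l)))
      ... | onImag b = subst (λ P → dot v P < α * β) (sym (point-imag b))
                         (subst (_< α * β) (sym (dot-imag (im b))) (*-monoʳ-<-0< 0<α (imagᵢ<β b i∼l)))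

      outer : ∀ l → SameBlock R j l → α * β ≤ dot v (point U l)
      outer l j∼l with side l
      ... | onReal a = subst (λ P → α * β ≤ dot v P) (sym (point-real a))
                         (subst₂ _≤_ (ℚP.*-comm β α) (sym (dot-real (re a))) (*-monoʳ-≤-0≤ (ℚP.<⇒≤ 0<β) (α≤realⱼ a j∼l)))
      ... | onImag b = subst (λ P → α * β ≤ dot v P) (sym (point-imag b))
                         (subst (α * β ≤_) (sym (dot-imag (im b))) (*-monoʳ-≤-0≤ (ℚP.<⇒≤ 0<α) (β≤imagⱼ b j∼l)))

    axisUncrossed⇒noncrossing : AxisUncrossed R → IsNoncrossing (point U) R
    axisUncrossed⇒noncrossing A i j i≁j (z , Hᵢ , Hⱼ) with inside-either A i j i≁j
    ... | inj₁ insideᵢⱼ = inside-separated i j insideᵢⱼ Hᵢ Hⱼ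
    ... | inj₂ insideⱼᵢ = inside-separated j i insideⱼᵢ Hⱼ Hᵢ

  private
    module ByRe = Sort.Sorting (Sort.sort (λ i → - re i) (λ i j eq → re-inj i j (ℚP.neg-injective eq)))
    module ByIm = Sort.Sorting (Sort.sort im im-inj)

  -- toPoint sends a position on the path of Uncrossed to the configuration index of the point there.
  toPoint : Fin (m + n) → Fin (m + n)
  toPoint l = [ (λ a → real (ByRe.at a)) , (λ b → imag (ByIm.at b)) ]′ (splitAt m l)

  toPosition : Fin (m + n) → Fin (m + n)
  toPosition l = [ (λ i → real (ByRe.rank i)) , (λ j → imag (ByIm.rank j)) ]′ (splitAt m l)

  toPoint-real : ∀ a → toPoint (real a) ≡ real (ByRe.at a)
  toPoint-real a = cong [ (λ a → real (ByRe.at a)) , (λ b → imag (ByIm.at b)) ]′ (FP.splitAt-↑ˡ m a n)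

  toPoint-imag : ∀ b → toPoint (imag b) ≡ imag (ByIm.at b)
  toPoint-imag b = cong [ (λ a → real (ByRe.at a)) , (λ b → imag (ByIm.at b)) ]′ (FP.splitAt-↑ʳ m n b)

  toPosition-real : ∀ i → toPosition (real i) ≡ real (ByRe.rank i)
  toPosition-real i = cong [ (λ i → real (ByRe.rank i)) , (λ j → imag (ByIm.rank j)) ]′ (FP.splitAt-↑ˡ m i n)

  toPosition-imag : ∀ j → toPosition (imag j) ≡ imag (ByIm.rank j)
  toPosition-imag j = cong [ (λ i → real (ByRe.rank i)) , (λ j → imag (ByIm.rank j)) ]′ (FP.splitAt-↑ʳ m n j)

  toPoint-rank-real : ∀ i → toPoint (real (ByRe.rank i)) ≡ real i
  toPoint-rank-real i = trans (toPoint-real _) (cong real (ByRe.at-rank i))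

  toPoint-rank-imag : ∀ j → toPoint (imag (ByIm.rank j)) ≡ imag j
  toPoint-rank-imag j = trans (toPoint-imag _) (cong imag (ByIm.at-rank j))

  toPoint-toPosition : ∀ l → toPoint (toPosition l) ≡ l
  toPoint-toPosition l with side l
  ... | onReal i = trans (cong toPoint (toPosition-real i)) (toPoint-rank-real i)
  ... | onImag j = trans (cong toPoint (toPosition-imag j)) (toPoint-rank-imag j)

  toPosition-toPoint : ∀ l → toPosition (toPoint l) ≡ l
  toPosition-toPoint l with side l
  ... | onReal a = trans (cong toPosition (toPoint-real a)) (trans (toPosition-real _) (cong real (ByRe.rank-at a)))
  ... | onImag b = trans (cong toPosition (toPoint-imag b)) (trans (toPosition-imag _) (cong imag (ByIm.rank-at b)))

  re-decreasing : ∀ {a b} → a F.< b → re (ByRe.at b) < re (ByRe.at a)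
  re-decreasing a<b = neg-cancel-< (ByRe.increasing a<b)

  toℕ-real : ∀ i → F.toℕ (real i) ≡ F.toℕ i
  toℕ-real i = FP.toℕ-↑ˡ i n

  toℕ-imag : ∀ j → F.toℕ (imag j) ≡ m + F.toℕ j
  toℕ-imag j = FP.toℕ-↑ʳ m j

  real<m : ∀ i → F.toℕ (real i) ℕ.< m
  real<m i = subst (ℕ._< m) (sym (toℕ-real i)) (FP.toℕ<n i)

  m≤imag : ∀ j → m ℕ.≤ F.toℕ (imag j)
  m≤imag j = subst (m ℕ.≤_) (sym (toℕ-imag j)) (ℕP.m≤m+n m (F.toℕ j))

  real-cancel-< : ∀ {a b} → real a F.< real b → a F.< b
  real-cancel-< {a} {b} = subst₂ ℕ._<_ (toℕ-real a) (toℕ-real b)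

  real-mono-< : ∀ {a b} → a F.< b → real a F.< real b
  real-mono-< {a} {b} = subst₂ ℕ._<_ (sym (toℕ-real a)) (sym (toℕ-real b))

  imag-cancel-< : ∀ {a b} → imag a F.< imag b → a F.< b
  imag-cancel-< {a} {b} h = ℕP.+-cancelˡ-< m _ _ (subst₂ ℕ._<_ (toℕ-imag a) (toℕ-imag b) h)

  imag-mono-< : ∀ {a b} → a F.< b → imag a F.< imag b
  imag-mono-< {a} {b} a<b = subst₂ ℕ._<_ (sym (toℕ-imag a)) (sym (toℕ-imag b)) (ℕP.+-monoʳ-< m a<b)

  imag≮real : ∀ {j i} → ¬ imag j F.< real i
  imag≮real {j} {i} j<i = ℕP.<-irrefl refl (ℕP.<-≤-trans (ℕP.<-trans j<i (real<m i)) (m≤imag j))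

  module _ {R : RelMat (m + n)} (P : IsPartition R) where

    private
      module P = IsPartition P

      points⁻ : ∀ {x y x′ y′} → toPoint x ≡ x′ → toPoint y ≡ y′ → SameBlock (reindex toPoint R) x y → SameBlock R x′ y′
      points⁻ refl refl = reindex⁻ toPoint R

      points⁺ : ∀ {x y x′ y′} → toPoint x ≡ x′ → toPoint y ≡ y′ → SameBlock R x′ y′ → SameBlock (reindex toPoint R) x y
      points⁺ refl refl = reindex⁺ toPoint R

    axisUncrossed⇒uncrossed : AxisUncrossed R → PathPartition.Uncrossed m (reindex toPoint R)
    axisUncrossed⇒uncrossed A = record { intervalʳ = interval-real ; intervalⁱ = interval-imag ; noCrossing = no-crossing }
      where
      module A = AxisUncrossed A
      R′ = reindex toPoint R

      interval-real : ∀ {p q r} → p F.< q → q F.< r → F.toℕ r ℕ.< m → SameBlock R′ p r → SameBlock R′ p q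
      interval-real {p} {q} {r} p<q q<r r<m h with side p | side q | side r
      ... | _        | _        | onImag c = contradiction (ℕP.<-≤-trans r<m (m≤imag c)) (ℕP.<-irrefl refl)
      ... | _        | onImag b | onReal c = contradiction q<r imag≮real
      ... | onImag a | onReal b | onReal c = contradiction p<q imag≮real
      ... | onReal a | onReal b | onReal c =
        points⁺ (toPoint-real a) (toPoint-real b)
          (P.trans _ _ _ a∼c (A.intervalʳ (re-decreasing (real-cancel-< q<r)) (re-decreasing (real-cancel-< p<q))
                                          (P.sym _ _ a∼c)))
        where
        a∼c = points⁻ (toPoint-real a) (toPoint-real c) h

      interval-imag : ∀ {p q r} → m ℕ.≤ F.toℕ p → p F.< q → q F.< r → SameBlock R′ p r → SameBlock R′ p q
      interval-imag {p} {q} {r} m≤p p<q q<r h with side p | side q | side r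
      ... | onReal a | _        | _        = contradiction (ℕP.<-≤-trans (real<m a) m≤p) (ℕP.<-irrefl refl)
      ... | onImag a | onReal b | _        = contradiction p<q imag≮real
      ... | onImag a | onImag b | onReal c = contradiction q<r imag≮real
      ... | onImag a | onImag b | onImag c =
        points⁺ (toPoint-imag a) (toPoint-imag b)
          (A.intervalⁱ (ByIm.increasing (imag-cancel-< p<q)) (ByIm.increasing (imag-cancel-< q<r))
                       (points⁻ (toPoint-imag a) (toPoint-imag c) h))

      no-crossing : ∀ {p q r s} → p F.< q → F.toℕ q ℕ.< m → m ℕ.≤ F.toℕ r → r F.< s →
                    SameBlock R′ p r → SameBlock R′ q s → SameBlock R′ p q
      no-crossing {p} {q} {r} {s} p<q q<m m≤r r<s h₁ h₂ with side p | side q | side r | side s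
      ... | _        | onImag b | _        | _        = contradiction (ℕP.<-≤-trans q<m (m≤imag b)) (ℕP.<-irrefl refl)
      ... | _        | onReal b | onReal c | _        = contradiction (ℕP.<-≤-trans (real<m c) m≤r) (ℕP.<-irrefl refl)
      ... | onImag a | onReal b | onImag c | _        = contradiction p<q imag≮real
      ... | onReal a | onReal b | onImag c | onReal d = contradiction r<s imag≮real
      ... | onReal a | onReal b | onImag c | onImag d =
        points⁺ (toPoint-real a) (toPoint-real b)
          (A.noCrossing (re-decreasing (real-cancel-< p<q)) (ByIm.increasing (imag-cancel-< r<s))
                        (points⁻ (toPoint-real a) (toPoint-imag c) h₁) (points⁻ (toPoint-real b) (toPoint-imag d) h₂))

    uncrossed⇒axisUncrossed : PathPartition.Uncrossed m (reindex toPoint R) → AxisUncrossed R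
    uncrossed⇒axisUncrossed Unc = record { intervalʳ = interval-real ; intervalⁱ = interval-imag ; noCrossing = no-crossing }
      where
      module Unc = PathPartition.Uncrossed Unc

      rank-decreasing : ∀ {i i′} → re i < re i′ → real (ByRe.rank i′) F.< real (ByRe.rank i)
      rank-decreasing re<re′ = real-mono-< (ByRe.rank-increasing (ℚP.neg-antimono-< re<re′))

      rank-increasing : ∀ {j j′} → im j < im j′ → imag (ByIm.rank j) F.< imag (ByIm.rank j′)
      rank-increasing im<im′ = imag-mono-< (ByIm.rank-increasing im<im′)

      interval-real : ∀ {i₁ i₂ i₃} → re i₁ < re i₂ → re i₂ < re i₃ →
                      SameBlock R (real i₁) (real i₃) → SameBlock R (real i₁) (real i₂)
      interval-real r₁<r₂ r₂<r₃ h =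
        P.trans _ _ _ h (points⁻ (toPoint-rank-real _) (toPoint-rank-real _)
          (Unc.intervalʳ (rank-decreasing r₂<r₃) (rank-decreasing r₁<r₂) (real<m _)
                         (points⁺ (toPoint-rank-real _) (toPoint-rank-real _) (P.sym _ _ h))))

      interval-imag : ∀ {j₁ j₂ j₃} → im j₁ < im j₂ → im j₂ < im j₃ →
                      SameBlock R (imag j₁) (imag j₃) → SameBlock R (imag j₁) (imag j₂)
      interval-imag s₁<s₂ s₂<s₃ h =
        points⁻ (toPoint-rank-imag _) (toPoint-rank-imag _)
          (Unc.intervalⁱ (m≤imag _) (rank-increasing s₁<s₂) (rank-increasing s₂<s₃)
                         (points⁺ (toPoint-rank-imag _) (toPoint-rank-imag _) h))

      no-crossing : ∀ {i₁ i₂ j₁ j₂} → re i₂ < re i₁ → im j₁ < im j₂ →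
                    SameBlock R (real i₁) (imag j₁) → SameBlock R (real i₂) (imag j₂) → SameBlock R (real i₁) (real i₂)
      no-crossing r₂<r₁ s₁<s₂ h₁ h₂ =
        points⁻ (toPoint-rank-real _) (toPoint-rank-real _)
          (Unc.noCrossing (rank-decreasing r₂<r₁) (real<m _) (m≤imag _) (rank-increasing s₁<s₂)
                          (points⁺ (toPoint-rank-real _) (toPoint-rank-imag _) h₁)
                          (points⁺ (toPoint-rank-real _) (toPoint-rank-imag _) h₂))

  noncrossing⇔pathNC : ∀ R → NC (point U) R ⇔ Image (reindex toPosition) (PathPartition.PathNC m) R
  noncrossing⇔pathNC R = mk⇔ to from
    where
    to : NC (point U) R → Image (reindex toPosition) (PathPartition.PathNC m) R
    to (P , noncrossing) =
      reindex toPoint R ,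
      (reindex-isPartition toPoint P , axisUncrossed⇒uncrossed P (noncrossing⇒axisUncrossed P noncrossing)) ,
      sym (reindex-inverse toPoint-toPosition R)

    from : Image (reindex toPosition) (PathPartition.PathNC m) R → NC (point U) R
    from (R₀ , (P₀ , Unc₀) , refl) = P , axisUncrossed⇒noncrossing P (uncrossed⇒axisUncrossed P Unc)
      where
      P = reindex-isPartition toPosition P₀
      Unc = subst (PathPartition.Uncrossed m) (sym (reindex-inverse toPosition-toPoint R₀)) Unc₀

  noncrossing-hasCard : HasCard (NC (point U)) (Counting.ncCount m n)
  noncrossing-hasCard =
    Counting.hasCard-⇔ noncrossing⇔pathNC
      (Counting.hasCard-image (reindex toPosition) (reindex-injective toPosition-toPoint) (Counting.pathNC-hasCard m n))

open import Defs
open import Data.Nat using (ℕ)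
open import Data.Integer using (+_)
open import Data.Product using (_×_; Σ; _,_)
open import Relation.Binary.PropositionalEquality using (_≡_; refl; sym; subst)
open import Relation.Nullary using (¬_)
open GeneratingFunction using (u≡ncCount; u-generatingFunction)

theorem3p3 : Σ (ℕ → ℕ → ℕ) λ u →
    (u 0 0 ≡ 0)
    × (∀ m n → ¬ (m ≡ 0 × n ≡ 0) → (U : Config m n) → HasCard (NC (point U)) (u m n))
    × (∀ m n → (denom ⊛ (λ i j → + u i j)) m n ≡ numer m n)
theorem3p3 =
  GeneratingFunction.u , refl ,
  (λ m n not00 U → subst (HasCard (NC (point U))) (sym (u≡ncCount m n not00)) (Configuration.noncrossing-hasCard U)) ,
  u-generatingFunction
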